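{- Let $a_4,a_6\in\mathbb Z$ with $\Delta:=-16(4a_4^3+27a_6^2)\ne0$, and put $\alpha_4=v_3(a_4)$, $\alpha_6=v_3(a_6)$, $d=v_3(\Delta)$. The model $y^2=x^3+a_4x+a_6$ is not $3$-minimal if and only if either (1) $\alpha_4\ge4$ and $\alpha_6\ge6$, or (2) $\alpha_4=\alpha_6=3$ and $d\ge12$.
   Context: $v_3$ is the $3$-adic valuation with $v_3(0)=+\infty$. A model is $3$-minimal if $v_3$ of its discriminant is minimal among all $3$-integral (general, long) Weierstrass models of the same elliptic curve. -}

module Defs where

open import Data.Nat as ℕ using (ℕ; zero; suc)
open import Data.Nat.DivMod using (_/_; _%_)
open import Data.Nat.Divisibility using (_∣_)
open import Data.Integer as ℤ using (ℤ; +_; ∣_∣)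
open import Data.Rational as Q using (ℚ; 0ℚ)
open import Data.Bool using (if_then_else_)
open import Data.Product using (_×_)
open import Relation.Nullary using (¬_)
open import Relation.Binary.PropositionalEquality using (_≡_)

data ℕ∞ : Set where
  fin : ℕ → ℕ∞
  ∞   : ℕ∞

infix 4 _≤∞_
data _≤∞_ : ℕ∞ → ℕ∞ → Set where
  fin≤fin : ∀ {m n} → m ℕ.≤ n → fin m ≤∞ fin n
  _≤∞∞    : ∀ x → x ≤∞ ∞

-- 3-adic valuation of a natural number, with fuel (fuel = n suffices)
v3fuel : ℕ → ℕ → ℕ
v3fuel zero    n = 0
v3fuel (suc f) zero = 0
v3fuel (suc f) (suc n) =
  if (suc n % 3) ℕ.≡ᵇ 0 then suc (v3fuel f (suc n / 3)) else 0

v3ℕ : ℕ → ℕ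
v3ℕ n = v3fuel n n

v3ℤ : ℤ → ℕ∞
v3ℤ (+ zero) = ∞
v3ℤ a = fin (v3ℕ ∣ a ∣)

-- v₃ on ℚ (only used on nonzero rationals; value at 0 is irrelevant)
v3ℚ : ℚ → ℤ
v3ℚ q = (+ v3ℕ ∣ ℚ.numerator q ∣) ℤ.- (+ v3ℕ (ℚ.denominatorℕ q))

Integral3ℚ : ℚ → Set
Integral3ℚ q = ¬ (3 ∣ ℚ.denominatorℕ q)

-- general (long) Weierstrass model y² + a1 xy + a3 y = x³ + a2 x² + a4 x + a6 over ℚ
record Model : Set where
  constructor mkModel
  field
    a1 a2 a3 a4 a6 : ℚ
open Model public

Integral3 : Model → Set
Integral3 W = Integral3ℚ (a1 W) × Integral3ℚ (a2 W) × Integral3ℚ (a3 W)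
            × Integral3ℚ (a4 W) × Integral3ℚ (a6 W)

q : ℤ → ℚ
q n = n Q./ 1

disc : Model → ℚ
disc W = Q.- (b2 Q.* b2 Q.* b8) Q.- q (+ 8) Q.* b4 Q.* b4 Q.* b4
         Q.- q (+ 27) Q.* b6 Q.* b6 Q.+ q (+ 9) Q.* b2 Q.* b4 Q.* b6
  where
  open Q using (_+_; _-_; _*_)
  A1 = a1 W ; A2 = a2 W ; A3 = a3 W ; A4 = a4 W ; A6 = a6 W
  b2 = A1 * A1 + q (+ 4) * A2
  b4 = q (+ 2) * A4 + A1 * A3
  b6 = A3 * A3 + q (+ 4) * A6
  b8 = A1 * A1 * A6 + q (+ 4) * A2 * A6 - A1 * A3 * A4 + A2 * A3 * A3 - A4 * A4

-- W' is obtained from W by the change of variables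
--   x = u² x' + r ,  y = u³ y' + s u² x' + t   (u,r,s,t ∈ ℚ, u ≠ 0)
-- (standard transformation formulas, written without division)
Iso : Model → Model → Set
Iso W W' = ∃u ℚ λ u → ∃u ℚ λ r → ∃u ℚ λ s → ∃u ℚ λ t →
    ¬ (u ≡ 0ℚ)
  × u * a1 W' ≡ A1 + q (+ 2) * s
  × u * u * a2 W' ≡ A2 - s * A1 + q (+ 3) * r - s * s
  × u * u * u * a3 W' ≡ A3 + r * A1 + q (+ 2) * t
  × u * u * u * u * a4 W' ≡ A4 - s * A3 + q (+ 2) * r * A2 - (t + r * s) * A1
                            + q (+ 3) * r * r - q (+ 2) * s * t
  × u * u * u * u * u * u * a6 W' ≡ A6 + r * A4 + r * r * A2 + r * r * r
                            - t * A3 - t * t - r * t * A1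
  where
  open Q using (_+_; _-_; _*_)
  open import Data.Product using (Σ)
  ∃u : (A : Set) → (A → Set) → Set
  ∃u = Σ
  A1 = a1 W ; A2 = a2 W ; A3 = a3 W ; A4 = a4 W ; A6 = a6 W

Minimal3 : Model → Set
Minimal3 W = Integral3 W × (∀ W' → Iso W W' → Integral3 W' → v3ℚ (disc W) ℤ.≤ v3ℚ (disc W'))

shortModel : ℤ → ℤ → Model
shortModel A4 A6 = mkModel 0ℚ 0ℚ 0ℚ (q A4) (q A6)

Δshort : ℤ → ℤ → ℤ
Δshort A4 A6 = ℤ.- (+ 16) ℤ.* (+ 4 ℤ.* A4 ℤ.* A4 ℤ.* A4 ℤ.+ + 27 ℤ.* A6 ℤ.* A6)

module Submission where

-- A change of variables with scaling factor u multiplies the discriminant by u⁻¹², so a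
-- 3-integral model is non-minimal exactly when some 3-integral model is reached with 3 ∣ u.
-- For y² = x³ + a₄x + a₆ the transformation formulas then force 3 ∣ s, 3 ∣ r, 3³ ∣ t, hence
-- 3³ ∣ a₄, 3³ ∣ a₆, 3¹² ∣ Δ, and 3⁶ ∣ a₆ as soon as 3⁴ ∣ a₄ (then 3² ∣ r).  Conversely,
-- u = 3 with r = s = t = 0 works in case (1), and u = 3, r = -3a₆/(2a₄), s = t = 0 in case (2);
-- if v₃(a₄) = 3 and v₃(a₆) ≥ 4, then v₃(Δ) = 9, which rules out the remaining case.

open import Defs
open import Data.Bool using (true; false)
open import Data.Integer as ℤ using (ℤ; +_; -[1+_]; +[1+_])
open import Data.Integer.Divisibility.Signed using (∣ᵤ⇒∣; divides)
import Data.Integer.Properties as ℤP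
import Data.Integer.Tactic.RingSolver as ℤ-Solver
open import Data.Nat as ℕ using (ℕ; zero; suc; _^_; _≤_; _<_; z≤n; s≤s; NonZero)
import Data.Nat.Coprimality as Coprimality
open import Data.Nat.Divisibility
  using (_∣_; divides; _∣?_; _∣0; m%n≡0⇒n∣m; ∣-trans; m∣m*n; ∣m⇒∣m*n; ∣n⇒∣m*n; *-cancelˡ-∣)
open import Data.Nat.DivMod using (_/_; _%_; m/n<m; m*n/n≡m; m*n%n≡0)
open import Data.Nat.GCD using (gcd; gcd-zeroʳ)
open import Data.Nat.Induction using (<-rec)
open import Data.Nat.Primality using (prime?; euclidsLemma)
import Data.Nat.Properties as ℕP
import Data.Nat.Tactic.RingSolver as ℕ-Solver
open import Data.Product using (_×_; _,_; proj₁; proj₂; ∃; ∃₂)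
open import Data.Product.Function.NonDependent.Propositional using (_×-⇔_)
open import Data.Rational as ℚ using (ℚ; 0ℚ; 1ℚ; ↥_; ↧_; ↧ₙ_; 1/_)
import Data.Rational.Properties as ℚP
open import Algebra.Bundles using (CommutativeMonoid)
open import Algebra.Definitions.RawSemiring ℚP.+-*-rawSemiring using () renaming (_^_ to _^ℚ_)
open import Algebra.Properties.CommutativeSemigroup
  (CommutativeMonoid.commutativeSemigroup ℚP.*-1-commutativeMonoid)
  using (interchange; xy∙z≈xz∙y; x∙yz≈y∙zx; x∙yz≈y∙xz)
open import Data.Rational.Solver using (module +-*-Solver)
open import Data.Rational.Unnormalised as ℚᵘ using (mkℚᵘ; *≡*)
import Data.Rational.Unnormalised.Properties as ℚᵘP
open import Data.Sum as Sum using (_⊎_; inj₁; inj₂; [_,_]′)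
open import Data.Sum.Function.Propositional using (_⊎-⇔_)
open import Function using (_∘_; id)
open import Function.Bundles using (_⇔_; mk⇔; Equivalence)
import Function.Properties.Equivalence as ⇔
open import Function.Related.TypeIsomorphisms using (¬-cong-⇔)
open import Relation.Binary.PropositionalEquality
open import Relation.Nullary using (¬_; Dec; yes; no; contradiction)
open import Relation.Nullary.Decidable using (from-yes; from-no; map; _×-dec_; _⊎-dec_; ¬?)

-- The 3-adic valuation on ℕ

module _ where
  open import Data.Nat using (_+_; _*_)

  3∣*⇒3∣⊎3∣ : ∀ m n → 3 ∣ m * n → 3 ∣ m ⊎ 3 ∣ n
  3∣*⇒3∣⊎3∣ m n = euclidsLemma m n (from-yes (prime? 3))

  3∤* : ∀ {m n} → ¬ 3 ∣ m → ¬ 3 ∣ n → ¬ 3 ∣ m * n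
  3∤* {m} {n} 3∤m 3∤n 3∣mn = [ 3∤m , 3∤n ]′ (3∣*⇒3∣⊎3∣ m n 3∣mn)

  3∤⇒nonZero : ∀ {n} → ¬ 3 ∣ n → NonZero n
  3∤⇒nonZero {zero}  3∤0 = contradiction (divides 0 refl) 3∤0
  3∤⇒nonZero {suc n} _   = _

  v3fuel-stable : ∀ f g n → n ≤ f → n ≤ g → v3fuel f n ≡ v3fuel g n
  v3fuel-stable zero    zero    _       _         _         = refl
  v3fuel-stable zero    (suc g) zero    _         _         = refl
  v3fuel-stable (suc f) zero    zero    _         _         = refl
  v3fuel-stable (suc f) (suc g) zero    _         _         = refl
  v3fuel-stable (suc f) (suc g) (suc n) (s≤s n≤f) (s≤s n≤g) with suc n % 3 ℕ.≡ᵇ 0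
  ... | true  = cong suc (v3fuel-stable f g (suc n / 3) (quotient≤ n≤f) (quotient≤ n≤g))
    where
    quotient≤ : ∀ {k} → n ≤ k → suc n / 3 ≤ k
    quotient≤ n≤k = ℕP.≤-pred (ℕP.≤-trans (m/n<m (suc n) 3 (s≤s (s≤s z≤n))) (s≤s n≤k))
  ... | false = refl

  v3fuel-3∣ : ∀ f n .{{_ : NonZero n}} → n % 3 ≡ 0 → v3fuel (suc f) n ≡ suc (v3fuel f (n / 3))
  v3fuel-3∣ f (suc n) n%3≡0 rewrite n%3≡0 = refl

  v3ℕ-*3 : ∀ m .{{_ : NonZero m}} → v3ℕ (m * 3) ≡ suc (v3ℕ m)
  v3ℕ-*3 m@(suc m-1) = begin
    v3fuel (m * 3) (m * 3)               ≡⟨ v3fuel-3∣ fuel (m * 3) (m*n%n≡0 m 3) ⟩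
    suc (v3fuel fuel (m * 3 / 3))        ≡⟨ cong (suc ∘ v3fuel fuel) (m*n/n≡m m 3) ⟩
    suc (v3fuel fuel m)                  ≡⟨ cong suc (v3fuel-stable fuel m m m≤fuel ℕP.≤-refl) ⟩
    suc (v3ℕ m)                          ∎
    where
    open ≡-Reasoning
    fuel : ℕ
    fuel = suc (suc (m-1 * 3))
    m≤fuel : m ≤ fuel
    m≤fuel = s≤s (ℕP.≤-trans (ℕP.m≤m*n m-1 3) (ℕP.n≤1+n _))

  v3ℕ-3∤ : ∀ n → ¬ 3 ∣ n → v3ℕ n ≡ 0
  v3ℕ-3∤ zero    3∤0 = contradiction (divides 0 refl) 3∤0
  v3ℕ-3∤ (suc n) 3∤n with suc n % 3 in eq
  ... | zero  = contradiction (m%n≡0⇒n∣m (suc n) 3 eq) 3∤n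
  ... | suc _ = refl

  v3ℕ-3^* : ∀ k m → ¬ 3 ∣ m → v3ℕ (3 ^ k * m) ≡ k
  v3ℕ-3^* zero    m 3∤m rewrite ℕP.*-identityˡ m = v3ℕ-3∤ m 3∤m
  v3ℕ-3^* (suc k) m 3∤m = begin
    v3ℕ (3 * 3 ^ k * m)    ≡⟨ cong v3ℕ (trans (ℕP.*-assoc 3 (3 ^ k) m) (ℕP.*-comm 3 (3 ^ k * m))) ⟩
    v3ℕ (3 ^ k * m * 3)    ≡⟨ v3ℕ-*3 (3 ^ k * m) {{ℕP.m*n≢0 (3 ^ k) m {{ℕP.m^n≢0 3 k}} {{3∤⇒nonZero 3∤m}}}} ⟩
    suc (v3ℕ (3 ^ k * m))  ≡⟨ cong suc (v3ℕ-3^* k m 3∤m) ⟩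
    suc k                  ∎
    where open ≡-Reasoning

  3-adic-split : ∀ n .{{_ : NonZero n}} → ∃₂ λ k m → ¬ 3 ∣ m × n ≡ 3 ^ k * m
  3-adic-split = <-rec (λ n → .{{_ : NonZero n}} → ∃₂ λ k m → ¬ 3 ∣ m × n ≡ 3 ^ k * m) split
    where
    split : ∀ n → (∀ {m} → m < n → .{{_ : NonZero m}} → ∃₂ λ k m′ → ¬ 3 ∣ m′ × m ≡ 3 ^ k * m′) →
            .{{_ : NonZero n}} → ∃₂ λ k m → ¬ 3 ∣ m × n ≡ 3 ^ k * m
    split n rec with 3 ∣? n
    ... | no 3∤n = 0 , n , 3∤n , sym (ℕP.*-identityˡ n)
    ... | yes (divides m refl) with rec (ℕP.m<m*n m 3 {{m≢0}} (s≤s (s≤s z≤n))) {{m≢0}}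
      where
      m≢0 : NonZero m
      m≢0 = ℕP.m*n≢0⇒m≢0 m
    ...   | k , m′ , 3∤m′ , refl =
      suc k , m′ , 3∤m′ , sym (trans (ℕP.*-assoc 3 (3 ^ k) m′) (ℕP.*-comm 3 (3 ^ k * m′)))

  v3ℕ-* : ∀ m n .{{_ : NonZero m}} .{{_ : NonZero n}} → v3ℕ (m * n) ≡ v3ℕ m + v3ℕ n
  v3ℕ-* m n with 3-adic-split m | 3-adic-split n
  ... | a , m′ , 3∤m′ , refl | b , n′ , 3∤n′ , refl = begin
    v3ℕ (3 ^ a * m′ * (3 ^ b * n′))      ≡⟨ cong v3ℕ (regroup (3 ^ a) m′ (3 ^ b) n′) ⟩
    v3ℕ (3 ^ a * 3 ^ b * (m′ * n′))      ≡⟨ cong (λ p → v3ℕ (p * (m′ * n′))) (ℕP.^-distribˡ-+-* 3 a b) ⟨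
    v3ℕ (3 ^ (a + b) * (m′ * n′))        ≡⟨ v3ℕ-3^* (a + b) (m′ * n′) (3∤* 3∤m′ 3∤n′) ⟩
    a + b                                ≡⟨ cong₂ _+_ (v3ℕ-3^* a m′ 3∤m′) (v3ℕ-3^* b n′ 3∤n′) ⟨
    v3ℕ (3 ^ a * m′) + v3ℕ (3 ^ b * n′)  ∎
    where
    open ≡-Reasoning
    regroup : ∀ x y z w → x * y * (z * w) ≡ x * z * (y * w)
    regroup = ℕ-Solver.solve-∀

  3^∣⇔≤v3ℕ : ∀ k n .{{_ : NonZero n}} → 3 ^ k ∣ n ⇔ k ≤ v3ℕ n
  3^∣⇔≤v3ℕ k n with 3-adic-split n
  ... | v , m , 3∤m , refl rewrite v3ℕ-3^* v m 3∤m = mk⇔ to from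
    where
    3^∣3^ : ∀ {i j} → i ≤ j → 3 ^ i ∣ 3 ^ j
    3^∣3^ {i} {j} i≤j = divides (3 ^ (j ℕ.∸ i)) (begin
      3 ^ j                   ≡⟨ cong (3 ^_) (ℕP.m+[n∸m]≡n i≤j) ⟨
      3 ^ (i + (j ℕ.∸ i))     ≡⟨ ℕP.^-distribˡ-+-* 3 i (j ℕ.∸ i) ⟩
      3 ^ i * 3 ^ (j ℕ.∸ i)   ≡⟨ ℕP.*-comm (3 ^ i) (3 ^ (j ℕ.∸ i)) ⟩
      3 ^ (j ℕ.∸ i) * 3 ^ i   ∎)
      where open ≡-Reasoning
    to : 3 ^ k ∣ 3 ^ v * m → k ≤ v
    to 3^k∣n = ℕP.≮⇒≥ λ v<k → 3∤m (*-cancelˡ-∣ (3 ^ v) {{ℕP.m^n≢0 3 v}}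
      (subst (_∣ 3 ^ v * m) (ℕP.*-comm 3 (3 ^ v)) (∣-trans (3^∣3^ v<k) 3^k∣n)))
    from : k ≤ v → 3 ^ k ∣ 3 ^ v * m
    from k≤v = ∣-trans (3^∣3^ k≤v) (m∣m*n m)

  3^∣*3∤⇒3^∣ : ∀ k a b → ¬ 3 ∣ b → 3 ^ k ∣ a * b → 3 ^ k ∣ a
  3^∣*3∤⇒3^∣ k zero      b 3∤b _      = (3 ^ k) ∣0
  3^∣*3∤⇒3^∣ k a@(suc _) b 3∤b 3^k∣ab = Equivalence.from (3^∣⇔≤v3ℕ k a) (begin
    k              ≤⟨ Equivalence.to (3^∣⇔≤v3ℕ k (a * b)) 3^k∣ab ⟩
    v3ℕ (a * b)    ≡⟨ v3ℕ-* a b ⟩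
    v3ℕ a + v3ℕ b  ≡⟨ cong (_+_ (v3ℕ a)) (v3ℕ-3∤ b 3∤b) ⟩
    v3ℕ a + 0      ≡⟨ ℕP.+-identityʳ (v3ℕ a) ⟩
    v3ℕ a          ∎)
    where
    open ℕP.≤-Reasoning
    instance
      _ = 3∤⇒nonZero 3∤b
      _ = ℕP.m*n≢0 a b

  fin≤fin⇔ : ∀ {m n} → fin m ≤∞ fin n ⇔ m ≤ n
  fin≤fin⇔ = mk⇔ (λ { (fin≤fin m≤n) → m≤n }) fin≤fin

  ≡fin⇔ : ∀ {x k} → x ≡ fin k ⇔ (fin k ≤∞ x × ¬ fin (suc k) ≤∞ x)
  ≡fin⇔ {x} {k} = mk⇔ to from
    where
    to : x ≡ fin k → fin k ≤∞ x × ¬ fin (suc k) ≤∞ x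
    to refl = fin≤fin ℕP.≤-refl , λ { (fin≤fin k<k) → ℕP.<-irrefl refl k<k }
    from : fin k ≤∞ x × ¬ fin (suc k) ≤∞ x → x ≡ fin k
    from (fin≤fin k≤n , k≮n) = cong fin (ℕP.≤-antisym (ℕP.≮⇒≥ (k≮n ∘ fin≤fin)) k≤n)
    from (_ ≤∞∞ , k≮∞)      = contradiction (_ ≤∞∞) k≮∞

  fin≤v3ℤ⇔3^∣ : ∀ k n → fin k ≤∞ v3ℤ n ⇔ 3 ^ k ∣ ℤ.∣ n ∣
  fin≤v3ℤ⇔3^∣ k (+ zero)  = mk⇔ (λ _ → (3 ^ k) ∣0) (λ _ → fin k ≤∞∞)
  fin≤v3ℤ⇔3^∣ k (+ suc n) = ⇔.trans fin≤fin⇔ (⇔.sym (3^∣⇔≤v3ℕ k (suc n)))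
  fin≤v3ℤ⇔3^∣ k -[1+ n ]  = ⇔.trans fin≤fin⇔ (⇔.sym (3^∣⇔≤v3ℕ k (suc n)))

open import Data.Integer using (∣_∣)
open import Data.Rational using (_+_; _*_; _-_; -_)

↥-q : ∀ n → ↥ q n ≡ n
↥-q n = begin
  ↥ q n                      ≡⟨ ℤP.*-identityʳ (↥ q n) ⟨
  ↥ q n ℤ.* + 1              ≡⟨ cong (λ g → ↥ q n ℤ.* + g) (gcd-zeroʳ ∣ n ∣) ⟨
  ↥ q n ℤ.* + gcd ∣ n ∣ 1    ≡⟨ ℚP.↥-/ n 1 ⟩
  n                          ∎
  where open ≡-Reasoning

q-injective : ∀ {m n} → q m ≡ q n → m ≡ n
q-injective {m} {n} qm≡qn = trans (sym (↥-q m)) (trans (cong ↥_ qm≡qn) (↥-q n))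

q≢0 : ∀ {n} → n ≢ + 0 → q n ≢ 0ℚ
q≢0 n≢0 = n≢0 ∘ q-injective

toℚᵘ-q : ∀ n → ℚ.toℚᵘ (q n) ℚᵘ.≃ mkℚᵘ n 0
toℚᵘ-q n = ℚP.toℚᵘ-fromℚᵘ (mkℚᵘ n 0)

q-* : ∀ m n → q (m ℤ.* n) ≡ q m * q n
q-* m n = ℚP.toℚᵘ-injective (begin
  ℚ.toℚᵘ (q (m ℤ.* n))              ≈⟨ toℚᵘ-q (m ℤ.* n) ⟩
  mkℚᵘ m 0 ℚᵘ.* mkℚᵘ n 0            ≈⟨ ℚᵘP.*-cong (toℚᵘ-q m) (toℚᵘ-q n) ⟨
  ℚ.toℚᵘ (q m) ℚᵘ.* ℚ.toℚᵘ (q n)    ≈⟨ ℚP.toℚᵘ-homo-* (q m) (q n) ⟨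
  ℚ.toℚᵘ (q m * q n)                ∎)
  where open ℚᵘP.≃-Reasoning

q-+ : ∀ m n → q (m ℤ.+ n) ≡ q m + q n
q-+ m n = ℚP.toℚᵘ-injective (begin
  ℚ.toℚᵘ (q (m ℤ.+ n))              ≈⟨ toℚᵘ-q (m ℤ.+ n) ⟩
  mkℚᵘ (m ℤ.+ n) 0                  ≈⟨ *≡* (cong (ℤ._* + 1) (cong₂ ℤ._+_ (ℤP.*-identityʳ m) (ℤP.*-identityʳ n))) ⟨
  mkℚᵘ m 0 ℚᵘ.+ mkℚᵘ n 0            ≈⟨ ℚᵘP.+-cong (toℚᵘ-q m) (toℚᵘ-q n) ⟨
  ℚ.toℚᵘ (q m) ℚᵘ.+ ℚ.toℚᵘ (q n)    ≈⟨ ℚP.toℚᵘ-homo-+ (q m) (q n) ⟨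
  ℚ.toℚᵘ (q m + q n)                ∎)
  where open ℚᵘP.≃-Reasoning

*-q↧ : ∀ x → x * q (↧ x) ≡ q (↥ x)
*-q↧ x@(ℚ.mkℚ n d-1 _) = ℚP.toℚᵘ-injective (begin
  ℚ.toℚᵘ (x * q (↧ x))              ≈⟨ ℚP.toℚᵘ-homo-* x (q (↧ x)) ⟩
  ℚ.toℚᵘ x ℚᵘ.* ℚ.toℚᵘ (q (↧ x))    ≈⟨ ℚᵘP.*-congˡ {ℚ.toℚᵘ x} (toℚᵘ-q (↧ x)) ⟩
  ℚ.toℚᵘ x ℚᵘ.* mkℚᵘ (↧ x) 0        ≈⟨ *≡* (trans (ℤP.*-identityʳ _)
                                              (cong (λ d → n ℤ.* + suc d) (sym (ℕP.*-identityʳ d-1)))) ⟩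
  mkℚᵘ (↥ x) 0                      ≈⟨ toℚᵘ-q (↥ x) ⟨
  ℚ.toℚᵘ (q (↥ x))                  ∎)
  where open ℚᵘP.≃-Reasoning

*-q↧*↧ : ∀ x y → x * y * q (↧ x ℤ.* ↧ y) ≡ q (↥ x ℤ.* ↥ y)
*-q↧*↧ x y = begin
  x * y * q (↧ x ℤ.* ↧ y)        ≡⟨ cong (x * y *_) (q-* (↧ x) (↧ y)) ⟩
  x * y * (q (↧ x) * q (↧ y))    ≡⟨ interchange x y (q (↧ x)) (q (↧ y)) ⟩
  x * q (↧ x) * (y * q (↧ y))    ≡⟨ cong₂ _*_ (*-q↧ x) (*-q↧ y) ⟩
  q (↥ x) * q (↥ y)              ≡⟨ q-* (↥ x) (↥ y) ⟨
  q (↥ x ℤ.* ↥ y)                ∎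
  where open ≡-Reasoning

+-q↧*↧ : ∀ x y → (x + y) * q (↧ x ℤ.* ↧ y) ≡ q (↥ x ℤ.* ↧ y ℤ.+ ↥ y ℤ.* ↧ x)
+-q↧*↧ x y = begin
  (x + y) * q (↧ x ℤ.* ↧ y)                      ≡⟨ cong ((x + y) *_) (q-* (↧ x) (↧ y)) ⟩
  (x + y) * (q (↧ x) * q (↧ y))                  ≡⟨ distrib x y (q (↧ x)) (q (↧ y)) ⟩
  x * q (↧ x) * q (↧ y) + y * q (↧ y) * q (↧ x)  ≡⟨ cong₂ (λ a b → a * q (↧ y) + b * q (↧ x)) (*-q↧ x) (*-q↧ y) ⟩
  q (↥ x) * q (↧ y) + q (↥ y) * q (↧ x)          ≡⟨ cong₂ _+_ (q-* (↥ x) (↧ y)) (q-* (↥ y) (↧ x)) ⟨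
  q (↥ x ℤ.* ↧ y) + q (↥ y ℤ.* ↧ x)              ≡⟨ q-+ (↥ x ℤ.* ↧ y) (↥ y ℤ.* ↧ x) ⟨
  q (↥ x ℤ.* ↧ y ℤ.+ ↥ y ℤ.* ↧ x)                ∎
  where
  open ≡-Reasoning
  distrib : ∀ a b c d → (a + b) * (c * d) ≡ a * c * d + b * d * c
  distrib = solve 4 (λ a b c d → (a :+ b) :* (c :* d) := a :* c :* d :+ b :* d :* c) refl
    where open +-*-Solver

*-cancelˡ : ∀ c {x y} → c ≢ 0ℚ → c * x ≡ c * y → x ≡ y
*-cancelˡ c {x} {y} c≢0 cx≡cy = begin
  x                ≡⟨ ℚP.*-identityˡ x ⟨
  1ℚ * x           ≡⟨ cong (_* x) (ℚP.*-inverseˡ c) ⟨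
  1/ c * c * x     ≡⟨ ℚP.*-assoc (1/ c) c x ⟩
  1/ c * (c * x)   ≡⟨ cong (1/ c *_) cx≡cy ⟩
  1/ c * (c * y)   ≡⟨ ℚP.*-assoc (1/ c) c y ⟨
  1/ c * c * y     ≡⟨ cong (_* y) (ℚP.*-inverseˡ c) ⟩
  1ℚ * y           ≡⟨ ℚP.*-identityˡ y ⟩
  y                ∎
  where
  open ≡-Reasoning
  instance _ = ℚ.≢-nonZero c≢0

*≢0 : ∀ {x y} → x ≢ 0ℚ → y ≢ 0ℚ → x * y ≢ 0ℚ
*≢0 {x} {y} x≢0 y≢0 xy≡0 = y≢0 (*-cancelˡ x x≢0 (trans xy≡0 (sym (ℚP.*-zeroʳ x))))

*≢0⇒≢0ʳ : ∀ {x y} → x * y ≢ 0ℚ → y ≢ 0ℚ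
*≢0⇒≢0ʳ {x} {y} xy≢0 refl = xy≢0 (ℚP.*-zeroʳ x)

cross-multiply : ∀ {x d n} → x * q d ≡ q n → ↥ x ℤ.* d ≡ n ℤ.* ↧ x
cross-multiply {x} {d} {n} x*d≡n = q-injective (begin
  q (↥ x ℤ.* d)       ≡⟨ q-* (↥ x) d ⟩
  q (↥ x) * q d       ≡⟨ cong (_* q d) (*-q↧ x) ⟨
  x * q (↧ x) * q d   ≡⟨ xy∙z≈xz∙y x (q (↧ x)) (q d) ⟩
  x * q d * q (↧ x)   ≡⟨ cong (_* q (↧ x)) x*d≡n ⟩
  q n * q (↧ x)       ≡⟨ q-* n (↧ x) ⟨
  q (n ℤ.* ↧ x)       ∎)
  where open ≡-Reasoning

∣∣-cong-* : ∀ a b c d → a ℤ.* b ≡ c ℤ.* d → ∣ a ∣ ℕ.* ∣ b ∣ ≡ ∣ c ∣ ℕ.* ∣ d ∣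
∣∣-cong-* a b c d ab≡cd = trans (sym (ℤP.abs-* a b)) (trans (cong ∣_∣ ab≡cd) (ℤP.abs-* c d))

3∤∣*∣ : ∀ {a b} → ¬ 3 ∣ ∣ a ∣ → ¬ 3 ∣ ∣ b ∣ → ¬ 3 ∣ ∣ a ℤ.* b ∣
3∤∣*∣ {a} {b} 3∤a 3∤b = 3∤* 3∤a 3∤b ∘ subst (3 ∣_) (ℤP.abs-* a b)

-- The ring ℤ₍₃₎ and its ideals 3ᵏℤ₍₃₎

¬3∣↥×↧ : ∀ x → ¬ (3 ∣ ∣ ↥ x ∣ × 3 ∣ ↧ₙ x)
¬3∣↥×↧ (ℚ.mkℚ _ _ coprime) 3∣both = 3≢1 (Coprimality.recompute coprime 3∣both)
  where
  3≢1 : 3 ≢ 1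
  3≢1 ()

-- A record rather than Integral3ℚ itself, so that x is determined by the type.
infix 4 _∈ℤ₍₃₎
record _∈ℤ₍₃₎ (x : ℚ) : Set where
  constructor integral
  field 3∤↧ : Integral3ℚ x
open _∈ℤ₍₃₎ public

3∣↥⇒integral : ∀ {x} → 3 ∣ ∣ ↥ x ∣ → x ∈ℤ₍₃₎
3∣↥⇒integral {x} 3∣↥x = integral λ 3∣↧x → ¬3∣↥×↧ x (3∣↥x , 3∣↧x)

frac⇒integral : ∀ {x n d} → ¬ 3 ∣ ∣ d ∣ → x * q d ≡ q n → x ∈ℤ₍₃₎
frac⇒integral {x} {n} {d} 3∤d x*d≡n = integral λ 3∣↧x →
  [ (λ 3∣↥x → ¬3∣↥×↧ x (3∣↥x , 3∣↧x)) , 3∤d ]′ (3∣*⇒3∣⊎3∣ ∣ ↥ x ∣ ∣ d ∣ (3∣↥x*d 3∣↧x))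
  where
  ↥x*d≡n*↧x : ∣ ↥ x ∣ ℕ.* ∣ d ∣ ≡ ∣ n ∣ ℕ.* ↧ₙ x
  ↥x*d≡n*↧x = ∣∣-cong-* (↥ x) d n (↧ x) (cross-multiply {x} {d} {n} x*d≡n)
  3∣↥x*d : 3 ∣ ↧ₙ x → 3 ∣ ∣ ↥ x ∣ ℕ.* ∣ d ∣
  3∣↥x*d 3∣↧x = subst (3 ∣_) (sym ↥x*d≡n*↧x) (∣n⇒∣m*n ∣ n ∣ 3∣↧x)

integral-q : ∀ n → q n ∈ℤ₍₃₎
integral-q n = frac⇒integral {q n} {n} {+ 1} (from-no (3 ∣? 1)) (ℚP.*-identityʳ (q n))

integral-+ : ∀ {x y} → x ∈ℤ₍₃₎ → y ∈ℤ₍₃₎ → x + y ∈ℤ₍₃₎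
integral-+ {x} {y} (integral 3∤↧x) (integral 3∤↧y) =
  frac⇒integral {x + y} {↥ x ℤ.* ↧ y ℤ.+ ↥ y ℤ.* ↧ x} {↧ x ℤ.* ↧ y} (3∤∣*∣ {↧ x} {↧ y} 3∤↧x 3∤↧y) (+-q↧*↧ x y)

integral-* : ∀ {x y} → x ∈ℤ₍₃₎ → y ∈ℤ₍₃₎ → x * y ∈ℤ₍₃₎
integral-* {x} {y} (integral 3∤↧x) (integral 3∤↧y) =
  frac⇒integral {x * y} {↥ x ℤ.* ↥ y} {↧ x ℤ.* ↧ y} (3∤∣*∣ {↧ x} {↧ y} 3∤↧x 3∤↧y) (*-q↧*↧ x y)

integral-neg : ∀ {x} → x ∈ℤ₍₃₎ → - x ∈ℤ₍₃₎
integral-neg {x} (integral 3∤↧x) = integral (subst (λ d → ¬ 3 ∣ d) (cong ∣_∣ (sym (ℚP.↧-neg x))) 3∤↧x)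

integral-1/ : ∀ {x} .{{_ : ℚ.NonZero x}} → ¬ 3 ∣ ∣ ↥ x ∣ → 1/ x ∈ℤ₍₃₎
integral-1/ {ℚ.mkℚ +[1+ n ] _ _} 3∤↥x = integral 3∤↥x
integral-1/ {ℚ.mkℚ -[1+ n ] _ _} 3∤↥x = integral 3∤↥x

3^ℚ : ℕ → ℚ
3^ℚ k = q (+ (3 ^ k))

3^ℚ-+ : ∀ m n → 3^ℚ (m ℕ.+ n) ≡ 3^ℚ m * 3^ℚ n
3^ℚ-+ m n = trans (cong q (trans (cong +_ (ℕP.^-distribˡ-+-* 3 m n)) (ℤP.pos-* (3 ^ m) (3 ^ n))))
                  (q-* (+ (3 ^ m)) (+ (3 ^ n)))

3^ℚ≢0 : ∀ k → 3^ℚ k ≢ 0ℚ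
3^ℚ≢0 k = q≢0 (λ 3^k≡0 → 3≢0 (ℕP.m^n≡0⇒m≡0 3 k (ℤP.+-injective 3^k≡0)))
  where
  3≢0 : 3 ≢ 0
  3≢0 ()

record Div₃ (k : ℕ) (x : ℚ) : Set where
  constructor div₃
  field
    cofactor      : ℚ
    cofactor∈ℤ₍₃₎ : cofactor ∈ℤ₍₃₎
    factorises    : x ≡ 3^ℚ k * cofactor

integral⇒div₃ : ∀ {x} → x ∈ℤ₍₃₎ → Div₃ 0 x
integral⇒div₃ {x} ix = div₃ x ix (sym (ℚP.*-identityˡ x))

div₃⇒integral : ∀ {k x} → Div₃ k x → x ∈ℤ₍₃₎
div₃⇒integral {k} (div₃ y y∈ x≡3^ky) = subst _∈ℤ₍₃₎ (sym x≡3^ky) (integral-* (integral-q (+ (3 ^ k))) y∈)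

div₃-3^ℚ : ∀ k → Div₃ k (3^ℚ k)
div₃-3^ℚ k = div₃ 1ℚ (integral-q (+ 1)) (sym (ℚP.*-identityʳ (3^ℚ k)))

div₃-+ : ∀ {k x y} → Div₃ k x → Div₃ k y → Div₃ k (x + y)
div₃-+ {k} (div₃ y₁ i₁ refl) (div₃ y₂ i₂ refl) =
  div₃ (y₁ + y₂) (integral-+ i₁ i₂) (sym (ℚP.*-distribˡ-+ (3^ℚ k) y₁ y₂))

div₃-neg : ∀ {k x} → Div₃ k x → Div₃ k (- x)
div₃-neg {k} (div₃ y i refl) = div₃ (- y) (integral-neg i) (ℚP.neg-distribʳ-* (3^ℚ k) y)

div₃-- : ∀ {k x y} → Div₃ k x → Div₃ k y → Div₃ k (x - y)
div₃-- x∈ y∈ = div₃-+ x∈ (div₃-neg y∈)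

div₃-+-cancelʳ : ∀ {k x y} → Div₃ k (x + y) → Div₃ k y → Div₃ k x
div₃-+-cancelʳ {k} {x} {y} x+y∈ y∈ = subst (Div₃ k) x+y-y≡x (div₃-- x+y∈ y∈)
  where
  x+y-y≡x : x + y - y ≡ x
  x+y-y≡x = trans (ℚP.+-assoc x y (- y)) (trans (cong (_+_ x) (ℚP.+-inverseʳ y)) (ℚP.+-identityʳ x))

div₃-+-cancelˡ : ∀ {k x y} → Div₃ k (x + y) → Div₃ k x → Div₃ k y
div₃-+-cancelˡ {k} {x} {y} x+y∈ = div₃-+-cancelʳ (subst (Div₃ k) (ℚP.+-comm x y) x+y∈)

div₃-* : ∀ {m n x y} → Div₃ m x → Div₃ n y → Div₃ (m ℕ.+ n) (x * y)
div₃-* {m} {n} {x} {y} (div₃ y₁ i₁ x≡3^my₁) (div₃ y₂ i₂ y≡3^ny₂) = div₃ (y₁ * y₂) (integral-* i₁ i₂) (begin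
  x * y                         ≡⟨ cong₂ _*_ x≡3^my₁ y≡3^ny₂ ⟩
  3^ℚ m * y₁ * (3^ℚ n * y₂)     ≡⟨ interchange (3^ℚ m) y₁ (3^ℚ n) y₂ ⟩
  3^ℚ m * 3^ℚ n * (y₁ * y₂)     ≡⟨ cong (_* (y₁ * y₂)) (3^ℚ-+ m n) ⟨
  3^ℚ (m ℕ.+ n) * (y₁ * y₂)     ∎)
  where open ≡-Reasoning

div₃-weaken : ∀ {m n x} → Div₃ (m ℕ.+ n) x → Div₃ m x
div₃-weaken {m} {n} (div₃ y i refl) =
  div₃ (3^ℚ n * y) (integral-* (integral-q (+ (3 ^ n))) i)
       (trans (cong (_* y) (3^ℚ-+ m n)) (ℚP.*-assoc (3^ℚ m) (3^ℚ n) y))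

div₃-≤ : ∀ {k l x} → k ℕ.≤ l → Div₃ l x → Div₃ k x
div₃-≤ {k} {l} {x} k≤l x∈ = div₃-weaken {k} {l ℕ.∸ k} (subst (λ j → Div₃ j x) (sym (ℕP.m+[n∸m]≡n k≤l)) x∈)

div₃-cancel-3^ : ∀ {m k x} → Div₃ (m ℕ.+ k) (3^ℚ m * x) → Div₃ k x
div₃-cancel-3^ {m} {k} {x} (div₃ y i e) = div₃ y i (*-cancelˡ (3^ℚ m) (3^ℚ≢0 m) (begin
  3^ℚ m * x              ≡⟨ e ⟩
  3^ℚ (m ℕ.+ k) * y      ≡⟨ cong (_* y) (3^ℚ-+ m k) ⟩
  3^ℚ m * 3^ℚ k * y      ≡⟨ ℚP.*-assoc (3^ℚ m) (3^ℚ k) y ⟩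
  3^ℚ m * (3^ℚ k * y)    ∎))
  where open ≡-Reasoning

div₃-cancel-unit : ∀ {k x} c → ¬ 3 ∣ ∣ c ∣ → Div₃ k (q c * x) → Div₃ k x
div₃-cancel-unit {k} {x} c 3∤c (div₃ y i e) = div₃ (y * c⁻¹) (integral-* i (integral-1/ {q c} 3∤↥c)) (begin
  x                      ≡⟨ ℚP.*-identityˡ x ⟨
  1ℚ * x                 ≡⟨ cong (_* x) (ℚP.*-inverseˡ (q c)) ⟨
  c⁻¹ * q c * x          ≡⟨ ℚP.*-assoc c⁻¹ (q c) x ⟩
  c⁻¹ * (q c * x)        ≡⟨ cong (c⁻¹ *_) e ⟩
  c⁻¹ * (3^ℚ k * y)      ≡⟨ x∙yz≈y∙zx c⁻¹ (3^ℚ k) y ⟩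
  3^ℚ k * (y * c⁻¹)      ∎)
  where
  open ≡-Reasoning
  instance _ = ℚ.≢-nonZero (q≢0 {c} (λ { refl → 3∤c (divides 0 refl) }))
  c⁻¹ : ℚ
  c⁻¹ = 1/ q c
  3∤↥c : ¬ 3 ∣ ∣ ↥ q c ∣
  3∤↥c = subst (λ n → ¬ 3 ∣ ∣ n ∣) (sym (↥-q c)) 3∤c

div₃⇒3^∣↥ : ∀ {k x} → Div₃ k x → 3 ^ k ∣ ∣ ↥ x ∣
div₃⇒3^∣↥ {k} {x} (div₃ y (integral 3∤↧y) x≡3^ky) =
  3^∣*3∤⇒3^∣ k ∣ ↥ x ∣ (↧ₙ y) 3∤↧y
    (subst (3 ^ k ∣_) (sym (∣∣-cong-* (↥ x) (↧ y) (+ (3 ^ k) ℤ.* ↥ y) (↧ x)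
                                      (cross-multiply {x} {↧ y} {+ (3 ^ k) ℤ.* ↥ y} x*↧y≡3^k↥y)))
      (∣m⇒∣m*n (↧ₙ x) (subst (3 ^ k ∣_) (sym (ℤP.abs-* (+ (3 ^ k)) (↥ y))) (m∣m*n ∣ ↥ y ∣))))
  where
  open ≡-Reasoning
  x*↧y≡3^k↥y : x * q (↧ y) ≡ q (+ (3 ^ k) ℤ.* ↥ y)
  x*↧y≡3^k↥y = begin
    x * q (↧ y)               ≡⟨ cong (_* q (↧ y)) x≡3^ky ⟩
    3^ℚ k * y * q (↧ y)       ≡⟨ ℚP.*-assoc (3^ℚ k) y (q (↧ y)) ⟩
    3^ℚ k * (y * q (↧ y))     ≡⟨ cong (3^ℚ k *_) (*-q↧ y) ⟩
    3^ℚ k * q (↥ y)           ≡⟨ q-* (+ (3 ^ k)) (↥ y) ⟨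
    q (+ (3 ^ k) ℤ.* ↥ y)     ∎

3^∣↥⇒div₃ : ∀ {k x} → x ∈ℤ₍₃₎ → 3 ^ k ∣ ∣ ↥ x ∣ → Div₃ k x
3^∣↥⇒div₃ {k} {x} (integral 3∤↧x) 3^k∣↥x with ∣ᵤ⇒∣ {+ (3 ^ k)} {↥ x} 3^k∣↥x
... | divides m ↥x≡m*3^k = div₃ (x * 3^-k) (frac⇒integral {x * 3^-k} {m} {↧ x} 3∤↧x y*↧x≡m) x≡3^k*y
  where
  open ≡-Reasoning
  instance _ = ℚ.≢-nonZero (3^ℚ≢0 k)
  3^-k : ℚ
  3^-k = 1/ 3^ℚ k
  y*↧x≡m : x * 3^-k * q (↧ x) ≡ q m
  y*↧x≡m = begin
    x * 3^-k * q (↧ x)          ≡⟨ xy∙z≈xz∙y x 3^-k (q (↧ x)) ⟩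
    x * q (↧ x) * 3^-k          ≡⟨ cong (_* 3^-k) (*-q↧ x) ⟩
    q (↥ x) * 3^-k              ≡⟨ cong (λ n → q n * 3^-k) ↥x≡m*3^k ⟩
    q (m ℤ.* + (3 ^ k)) * 3^-k  ≡⟨ cong (_* 3^-k) (q-* m (+ (3 ^ k))) ⟩
    q m * 3^ℚ k * 3^-k          ≡⟨ ℚP.*-assoc (q m) (3^ℚ k) 3^-k ⟩
    q m * (3^ℚ k * 3^-k)        ≡⟨ cong (q m *_) (ℚP.*-inverseʳ (3^ℚ k)) ⟩
    q m * 1ℚ                    ≡⟨ ℚP.*-identityʳ (q m) ⟩
    q m                         ∎
  x≡3^k*y : x ≡ 3^ℚ k * (x * 3^-k)
  x≡3^k*y = begin
    x                          ≡⟨ ℚP.*-identityʳ x ⟨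
    x * 1ℚ                     ≡⟨ cong (x *_) (ℚP.*-inverseʳ (3^ℚ k)) ⟨
    x * (3^ℚ k * 3^-k)         ≡⟨ x∙yz≈y∙xz x (3^ℚ k) 3^-k ⟩
    3^ℚ k * (x * 3^-k)         ∎

div₃⇔3^∣↥ : ∀ {k x} → x ∈ℤ₍₃₎ → Div₃ k x ⇔ 3 ^ k ∣ ∣ ↥ x ∣
div₃⇔3^∣↥ x∈ = mk⇔ div₃⇒3^∣↥ (3^∣↥⇒div₃ x∈)

div₃-q⇔3^∣ : ∀ {k} n → Div₃ k (q n) ⇔ 3 ^ k ∣ ∣ n ∣
div₃-q⇔3^∣ {k} n = subst (λ m → Div₃ k (q n) ⇔ 3 ^ k ∣ ∣ m ∣) (↥-q n) (div₃⇔3^∣↥ (integral-q n))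

div₃? : ∀ {x} → x ∈ℤ₍₃₎ → ∀ k → Dec (Div₃ k x)
div₃? {x} x∈ k = map (⇔.sym (div₃⇔3^∣↥ x∈)) (3 ^ k ∣? ∣ ↥ x ∣)

div₃₁⊎3∤↥ : ∀ x → Div₃ 1 x ⊎ ¬ 3 ∣ ∣ ↥ x ∣
div₃₁⊎3∤↥ x with 3 ∣? ∣ ↥ x ∣
... | yes 3∣↥x = inj₁ (3^∣↥⇒div₃ (3∣↥⇒integral 3∣↥x) 3∣↥x)
... | no 3∤↥x  = inj₂ 3∤↥x

div₃₁-prime : ∀ {x y} → x ∈ℤ₍₃₎ → y ∈ℤ₍₃₎ → Div₃ 1 (x * y) → Div₃ 1 x ⊎ Div₃ 1 y
div₃₁-prime {x} {y} x∈ y∈ xy∈ =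
  Sum.map (3^∣↥⇒div₃ x∈) (3^∣↥⇒div₃ y∈) (3∣*⇒3∣⊎3∣ ∣ ↥ x ∣ ∣ ↥ y ∣ 3∣↥x↥y)
  where
  ↥xy↧x↧y≡↥x↥y↧xy : ∣ ↥ (x * y) ∣ ℕ.* ∣ ↧ x ℤ.* ↧ y ∣ ≡ ∣ ↥ x ℤ.* ↥ y ∣ ℕ.* ↧ₙ (x * y)
  ↥xy↧x↧y≡↥x↥y↧xy = ∣∣-cong-* (↥ (x * y)) (↧ x ℤ.* ↧ y) (↥ x ℤ.* ↥ y) (↧ (x * y))
    (cross-multiply {x * y} {↧ x ℤ.* ↧ y} {↥ x ℤ.* ↥ y} (*-q↧*↧ x y))
  3∣↥x↥y↧xy : 3 ∣ ∣ ↥ x ℤ.* ↥ y ∣ ℕ.* ↧ₙ (x * y)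
  3∣↥x↥y↧xy = subst (3 ∣_) ↥xy↧x↧y≡↥x↥y↧xy (∣m⇒∣m*n ∣ ↧ x ℤ.* ↧ y ∣ (div₃⇒3^∣↥ xy∈))
  3∣↥x↥y : 3 ∣ ∣ ↥ x ∣ ℕ.* ∣ ↥ y ∣
  3∣↥x↥y = subst (3 ∣_) (ℤP.abs-* (↥ x) (↥ y))
    (3^∣*3∤⇒3^∣ 1 ∣ ↥ x ℤ.* ↥ y ∣ (↧ₙ (x * y)) (3∤↧ (integral-* x∈ y∈)) 3∣↥x↥y↧xy)

div₃-lift : ∀ {k j x} (x∈ : Div₃ k x) → Div₃ j (Div₃.cofactor x∈) → Div₃ (k ℕ.+ j) x
div₃-lift {k} {j} {x} (div₃ y _ x≡3^ky) y∈ =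
  subst (Div₃ (k ℕ.+ j)) (sym x≡3^ky) (div₃-* (div₃-3^ℚ k) y∈)

div₃-cancel : ∀ {k j x} (x∈ : Div₃ k x) → Div₃ (k ℕ.+ j) x → Div₃ j (Div₃.cofactor x∈)
div₃-cancel {k} {j} (div₃ y _ x≡3^ky) x∈ = div₃-cancel-3^ (subst (Div₃ (k ℕ.+ j)) x≡3^ky x∈)

div₃-sq : ∀ {k x} → Div₃ k x → Div₃ (k ℕ.+ k ℕ.+ 1) (x * x) → Div₃ (k ℕ.+ 1) x
div₃-sq x∈@(div₃ y y∈ _) xx∈ =
  div₃-lift x∈ ([ id , id ]′ (div₃₁-prime y∈ y∈ (div₃-cancel {j = 1} (div₃-* x∈ x∈) xx∈)))

div₃-cube : ∀ {k x} → Div₃ k x → Div₃ (k ℕ.+ k ℕ.+ k ℕ.+ 1) (x * x * x) → Div₃ (k ℕ.+ 1) x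
div₃-cube x∈@(div₃ y y∈ _) xxx∈ = div₃-lift x∈ ([ [ id , id ]′ ∘ div₃₁-prime y∈ y∈ , id ]′ yy∈⊎y∈)
  where
  yy∈⊎y∈ : Div₃ 1 (y * y) ⊎ Div₃ 1 y
  yy∈⊎y∈ = div₃₁-prime (integral-* y∈ y∈) y∈ (div₃-cancel {j = 1} (div₃-* (div₃-* x∈ x∈) x∈) xxx∈)
div₃₁-^ : ∀ n {x} → Div₃ 1 x → Div₃ n (x ^ℚ n)
div₃₁-^ zero    x∈ = div₃-3^ℚ 0
div₃₁-^ (suc n) x∈ = div₃-* x∈ (div₃₁-^ n x∈)

integral-inverse : ∀ {x} → x ∈ℤ₍₃₎ → ¬ Div₃ 1 x → ∃ λ w → w ∈ℤ₍₃₎ × x * w ≡ 1ℚ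
integral-inverse {x} x∈ x∉ = 1/ x , integral-1/ 3∤↥x , ℚP.*-inverseʳ x
  where
  3∤↥x : ¬ 3 ∣ ∣ ↥ x ∣
  3∤↥x 3∣↥x = x∉ (3^∣↥⇒div₃ x∈ 3∣↥x)
  instance _ = ℚ.≢-nonZero (λ x≡0 → 3∤↥x (subst (λ n → 3 ∣ ∣ n ∣) (sym (ℚP.p≡0⇒↥p≡0 x x≡0)) (divides 0 refl)))

∣↥∣≢0 : ∀ {x} → x ≢ 0ℚ → NonZero ∣ ↥ x ∣
∣↥∣≢0 {x} x≢0 = ℕ.≢-nonZero (λ ∣↥x∣≡0 → x≢0 (ℚP.↥p≡0⇒p≡0 x (ℤP.∣i∣≡0⇒i≡0 ∣↥x∣≡0)))

v3ℚ-* : ∀ {x y} → x ≢ 0ℚ → y ≢ 0ℚ → v3ℚ (x * y) ≡ v3ℚ x ℤ.+ v3ℚ y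
v3ℚ-* {x} {y} x≢0 y≢0 = begin
  + a ℤ.- + z                                      ≡⟨ shift (+ a) (+ z) (+ b) (+ c) ⟩
  (+ a ℤ.+ (+ b ℤ.+ + c)) ℤ.- + z ℤ.- + b ℤ.- + c  ≡⟨ cong (λ s → + s ℤ.- + z ℤ.- + b ℤ.- + c) valuations ⟩
  (+ x₁ ℤ.+ + y₁ ℤ.+ + z) ℤ.- + z ℤ.- + b ℤ.- + c  ≡⟨ unshift (+ x₁) (+ y₁) (+ z) (+ b) (+ c) ⟩
  (+ x₁ ℤ.- + b) ℤ.+ (+ y₁ ℤ.- + c)                ∎
  where
  open ≡-Reasoning
  instance
    _ = ∣↥∣≢0 x≢0
    _ = ∣↥∣≢0 y≢0
    _ = ∣↥∣≢0 (*≢0 x≢0 y≢0)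
    _ = ℕP.m*n≢0 (↧ₙ x) (↧ₙ y)
    _ = ℕP.m*n≢0 ∣ ↥ x ∣ ∣ ↥ y ∣
  a z b c x₁ y₁ : ℕ
  a = v3ℕ ∣ ↥ (x * y) ∣
  z = v3ℕ (↧ₙ (x * y))
  b = v3ℕ (↧ₙ x)
  c = v3ℕ (↧ₙ y)
  x₁ = v3ℕ ∣ ↥ x ∣
  y₁ = v3ℕ ∣ ↥ y ∣
  cross : ∣ ↥ (x * y) ∣ ℕ.* (↧ₙ x ℕ.* ↧ₙ y) ≡ ∣ ↥ x ∣ ℕ.* ∣ ↥ y ∣ ℕ.* ↧ₙ (x * y)
  cross = trans (∣∣-cong-* (↥ (x * y)) (↧ x ℤ.* ↧ y) (↥ x ℤ.* ↥ y) (↧ (x * y))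
                  (cross-multiply {x * y} {↧ x ℤ.* ↧ y} {↥ x ℤ.* ↥ y} (*-q↧*↧ x y)))
                (cong (ℕ._* ↧ₙ (x * y)) (ℤP.abs-* (↥ x) (↥ y)))
  valuations : a ℕ.+ (b ℕ.+ c) ≡ x₁ ℕ.+ y₁ ℕ.+ z
  valuations = begin
    a ℕ.+ (b ℕ.+ c)                                       ≡⟨ cong (a ℕ.+_) (v3ℕ-* (↧ₙ x) (↧ₙ y)) ⟨
    a ℕ.+ v3ℕ (↧ₙ x ℕ.* ↧ₙ y)                             ≡⟨ v3ℕ-* ∣ ↥ (x * y) ∣ (↧ₙ x ℕ.* ↧ₙ y) ⟨
    v3ℕ (∣ ↥ (x * y) ∣ ℕ.* (↧ₙ x ℕ.* ↧ₙ y))              ≡⟨ cong v3ℕ cross ⟩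
    v3ℕ (∣ ↥ x ∣ ℕ.* ∣ ↥ y ∣ ℕ.* ↧ₙ (x * y))             ≡⟨ v3ℕ-* (∣ ↥ x ∣ ℕ.* ∣ ↥ y ∣) (↧ₙ (x * y)) ⟩
    v3ℕ (∣ ↥ x ∣ ℕ.* ∣ ↥ y ∣) ℕ.+ z                      ≡⟨ cong (ℕ._+ z) (v3ℕ-* ∣ ↥ x ∣ ∣ ↥ y ∣) ⟩
    x₁ ℕ.+ y₁ ℕ.+ z                                       ∎
  shift : ∀ a z b c → a ℤ.- z ≡ (a ℤ.+ (b ℤ.+ c)) ℤ.- z ℤ.- b ℤ.- c
  shift = ℤ-Solver.solve-∀
  unshift : ∀ x y z b c → (x ℤ.+ y ℤ.+ z) ℤ.- z ℤ.- b ℤ.- c ≡ (x ℤ.- b) ℤ.+ (y ℤ.- c)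
  unshift = ℤ-Solver.solve-∀

v3ℚ≤0 : ∀ {x} → ¬ 3 ∣ ∣ ↥ x ∣ → v3ℚ x ℤ.≤ + 0
v3ℚ≤0 {x} 3∤↥x =
  subst (λ v → + v ℤ.- + v3ℕ (↧ₙ x) ℤ.≤ + 0) (sym (v3ℕ-3∤ ∣ ↥ x ∣ 3∤↥x)) (ℤP.i-j≤i (+ 0) (+ v3ℕ (↧ₙ x)))

^≢0 : ∀ n {x} → x ≢ 0ℚ → x ^ℚ n ≢ 0ℚ
^≢0 zero    x≢0 ()
^≢0 (suc n) x≢0 = *≢0 x≢0 (^≢0 n x≢0)

v3ℚ-^≤0 : ∀ n {x} → x ≢ 0ℚ → v3ℚ x ℤ.≤ + 0 → v3ℚ (x ^ℚ n) ℤ.≤ + 0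
v3ℚ-^≤0 zero    x≢0 v≤0 = ℤP.≤-refl
v3ℚ-^≤0 (suc n) {x} x≢0 v≤0 =
  subst (ℤ._≤ + 0) (sym (v3ℚ-* x≢0 (^≢0 n x≢0))) (ℤP.+-mono-≤ v≤0 (v3ℚ-^≤0 n x≢0 v≤0))

-- Discriminants under changes of variables

-- Defs.disc transcribed into the syntax of the ring solver, which cannot unfold disc itself.
discPoly : ∀ {n} → (A1 A2 A3 A4 A6 : +-*-Solver.Polynomial n) → +-*-Solver.Polynomial n
discPoly {n} A1 A2 A3 A4 A6 =
  :- (b2 :* b2 :* b8) :- con (q (+ 8)) :* b4 :* b4 :* b4 :- con (q (+ 27)) :* b6 :* b6
    :+ con (q (+ 9)) :* b2 :* b4 :* b6
  where
  open +-*-Solver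
  b2 b4 b6 b8 : Polynomial n
  b2 = A1 :* A1 :+ con (q (+ 4)) :* A2
  b4 = con (q (+ 2)) :* A4 :+ A1 :* A3
  b6 = A3 :* A3 :+ con (q (+ 4)) :* A6
  b8 = A1 :* A1 :* A6 :+ con (q (+ 4)) :* A2 :* A6 :- A1 :* A3 :* A4 :+ A2 :* A3 :* A3 :- A4 :* A4

scale : ℚ → Model → Model
scale u (mkModel A1 A2 A3 A4 A6) =
  mkModel (u * A1) (u * u * A2) (u * u * u * A3) (u * u * u * u * A4) (u * u * u * u * u * u * A6)

translate : ℚ → ℚ → ℚ → Model → Model
translate r s t (mkModel A1 A2 A3 A4 A6) =
  mkModel (A1 + q (+ 2) * s) (A2 - s * A1 + q (+ 3) * r - s * s) (A3 + r * A1 + q (+ 2) * t)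
          (A4 - s * A3 + q (+ 2) * r * A2 - (t + r * s) * A1 + q (+ 3) * r * r - q (+ 2) * s * t)
          (A6 + r * A4 + r * r * A2 + r * r * r - t * A3 - t * t - r * t * A1)

disc-scale : ∀ u W → disc (scale u W) ≡ u ^ℚ 12 * disc W
disc-scale u (mkModel A1 A2 A3 A4 A6) = solve 6 (λ u A1 A2 A3 A4 A6 →
  discPoly (u :* A1) (u :* u :* A2) (u :* u :* u :* A3) (u :* u :* u :* u :* A4) (u :* u :* u :* u :* u :* u :* A6)
    := u :^ 12 :* discPoly A1 A2 A3 A4 A6) refl u A1 A2 A3 A4 A6
  where open +-*-Solver

disc-translate : ∀ r s t W → disc (translate r s t W) ≡ disc W
disc-translate r s t (mkModel A1 A2 A3 A4 A6) = solve 8 (λ A1 A2 A3 A4 A6 r s t →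
  discPoly (A1 :+ con (q (+ 2)) :* s) (A2 :- s :* A1 :+ con (q (+ 3)) :* r :- s :* s)
           (A3 :+ r :* A1 :+ con (q (+ 2)) :* t)
           (A4 :- s :* A3 :+ con (q (+ 2)) :* r :* A2 :- (t :+ r :* s) :* A1
              :+ con (q (+ 3)) :* r :* r :- con (q (+ 2)) :* s :* t)
           (A6 :+ r :* A4 :+ r :* r :* A2 :+ r :* r :* r :- t :* A3 :- t :* t :- r :* t :* A1)
    := discPoly A1 A2 A3 A4 A6) refl A1 A2 A3 A4 A6 r s t
  where open +-*-Solver

mkModel-cong : ∀ {a1 a2 a3 a4 a6 b1 b2 b3 b4 b6} →
  a1 ≡ b1 → a2 ≡ b2 → a3 ≡ b3 → a4 ≡ b4 → a6 ≡ b6 → mkModel a1 a2 a3 a4 a6 ≡ mkModel b1 b2 b3 b4 b6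
mkModel-cong refl refl refl refl refl = refl

disc-iso : ∀ {W W'} (iso : Iso W W') → disc W ≡ proj₁ iso ^ℚ 12 * disc W'
disc-iso {W} {W'} (u , r , s , t , _ , e1 , e2 , e3 , e4 , e6) = begin
  disc W                     ≡⟨ disc-translate r s t W ⟨
  disc (translate r s t W)   ≡⟨ cong disc (mkModel-cong e1 e2 e3 e4 e6) ⟨
  disc (scale u W')          ≡⟨ disc-scale u W' ⟩
  u ^ℚ 12 * disc W'           ∎
  where open ≡-Reasoning

iso-from-scale : ∀ {W W'} u r s t → u ≢ 0ℚ → scale u W' ≡ translate r s t W → Iso W W'
iso-from-scale u r s t u≢0 W′≡W = u , r , s , t , u≢0 ,
  cong a1 W′≡W , cong a2 W′≡W , cong a3 W′≡W , cong a4 W′≡W , cong a6 W′≡W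

integral-disc : ∀ {W} → Integral3 W → disc W ∈ℤ₍₃₎
integral-disc {mkModel A1 A2 A3 A4 A6} (i1 , i2 , i3 , i4 , i6) =
  integral-+ (integral-+ (integral-+ (integral-neg (b2 ⊗ b2 ⊗ b8)) (integral-neg (c 8 ⊗ b4 ⊗ b4 ⊗ b4)))
                         (integral-neg (c 27 ⊗ b6 ⊗ b6)))
             (c 9 ⊗ b2 ⊗ b4 ⊗ b6)
  where
  _⊕_ : ∀ {x y} → x ∈ℤ₍₃₎ → y ∈ℤ₍₃₎ → x + y ∈ℤ₍₃₎
  _⊕_ = integral-+
  _⊗_ : ∀ {x y} → x ∈ℤ₍₃₎ → y ∈ℤ₍₃₎ → x * y ∈ℤ₍₃₎
  _⊗_ = integral-*
  _⊖_ : ∀ {x y} → x ∈ℤ₍₃₎ → y ∈ℤ₍₃₎ → x - y ∈ℤ₍₃₎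
  x∈ ⊖ y∈ = integral-+ x∈ (integral-neg y∈)
  infixl 6 _⊕_ _⊖_
  infixl 7 _⊗_
  c : ∀ n → q (+ n) ∈ℤ₍₃₎
  c n = integral-q (+ n)
  a1∈ : A1 ∈ℤ₍₃₎
  a1∈ = integral i1
  a2∈ : A2 ∈ℤ₍₃₎
  a2∈ = integral i2
  a3∈ : A3 ∈ℤ₍₃₎
  a3∈ = integral i3
  a4∈ : A4 ∈ℤ₍₃₎
  a4∈ = integral i4
  a6∈ : A6 ∈ℤ₍₃₎
  a6∈ = integral i6
  b2 : A1 * A1 + q (+ 4) * A2 ∈ℤ₍₃₎
  b2 = a1∈ ⊗ a1∈ ⊕ c 4 ⊗ a2∈
  b4 : q (+ 2) * A4 + A1 * A3 ∈ℤ₍₃₎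
  b4 = c 2 ⊗ a4∈ ⊕ a1∈ ⊗ a3∈
  b6 : A3 * A3 + q (+ 4) * A6 ∈ℤ₍₃₎
  b6 = a3∈ ⊗ a3∈ ⊕ c 4 ⊗ a6∈
  b8 : A1 * A1 * A6 + q (+ 4) * A2 * A6 - A1 * A3 * A4 + A2 * A3 * A3 - A4 * A4 ∈ℤ₍₃₎
  b8 = a1∈ ⊗ a1∈ ⊗ a6∈ ⊕ c 4 ⊗ a2∈ ⊗ a6∈ ⊖ a1∈ ⊗ a3∈ ⊗ a4∈ ⊕ a2∈ ⊗ a3∈ ⊗ a3∈ ⊖ a4∈ ⊗ a4∈

3∣u⇒disc-div₃-12 : ∀ {W W'} (iso : Iso W W') → Integral3 W' → Div₃ 1 (proj₁ iso) → Div₃ 12 (disc W)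
3∣u⇒disc-div₃-12 {W} {W'} iso W'∈ u∈ =
  subst (Div₃ 12) (sym (disc-iso {W} {W'} iso)) (div₃-* (div₃₁-^ 12 u∈) (integral⇒div₃ (integral-disc {W'} W'∈)))

v3ℚ-3^12 : v3ℚ (q (+ 3) ^ℚ 12) ≡ + 12
v3ℚ-3^12 = refl

v3ℚ-disc-≤ : ∀ {W W'} (iso : Iso W W') → disc W ≢ 0ℚ → ¬ 3 ∣ ∣ ↥ (proj₁ iso) ∣ → v3ℚ (disc W) ℤ.≤ v3ℚ (disc W')
v3ℚ-disc-≤ {W} {W'} iso@(u , _ , _ , _ , u≢0 , _) D≢0 3∤↥u = begin
  v3ℚ (disc W)                          ≡⟨ cong v3ℚ D≡ ⟩
  v3ℚ (u ^ℚ 12 * disc W')                ≡⟨ v3ℚ-* {u ^ℚ 12} {disc W'} (^≢0 12 u≢0) D′≢0 ⟩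
  v3ℚ (u ^ℚ 12) ℤ.+ v3ℚ (disc W')        ≤⟨ ℤP.+-monoˡ-≤ (v3ℚ (disc W')) (v3ℚ-^≤0 12 u≢0 (v3ℚ≤0 {u} 3∤↥u)) ⟩
  + 0 ℤ.+ v3ℚ (disc W')                 ≡⟨ ℤP.+-identityˡ (v3ℚ (disc W')) ⟩
  v3ℚ (disc W')                         ∎
  where
  open ℤP.≤-Reasoning
  D≡ : disc W ≡ u ^ℚ 12 * disc W'
  D≡ = disc-iso {W} {W'} iso
  D′≢0 : disc W' ≢ 0ℚ
  D′≢0 = *≢0⇒≢0ʳ {u ^ℚ 12} (subst (_≢ 0ℚ) D≡ D≢0)

¬minimal-by-3 : ∀ {W W'} (iso : Iso W W') → proj₁ iso ≡ q (+ 3) → disc W ≢ 0ℚ → Integral3 W' → ¬ Minimal3 W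
¬minimal-by-3 {W} {W'} iso u≡3 D≢0 W'∈ (_ , minimal) =
  contradiction (subst (ℤ._≤ v3ℚ (disc W')) v≡12+v′ (minimal W' iso W'∈)) (12+v≰v (v3ℚ (disc W')))
  where
  D≡ : disc W ≡ q (+ 3) ^ℚ 12 * disc W'
  D≡ = trans (disc-iso {W} {W'} iso) (cong (λ u → u ^ℚ 12 * disc W') u≡3)
  D′≢0 : disc W' ≢ 0ℚ
  D′≢0 = *≢0⇒≢0ʳ {q (+ 3) ^ℚ 12} (subst (_≢ 0ℚ) D≡ D≢0)
  v≡12+v′ : v3ℚ (disc W) ≡ + 12 ℤ.+ v3ℚ (disc W')
  v≡12+v′ = trans (cong v3ℚ D≡) (trans (v3ℚ-* {q (+ 3) ^ℚ 12} {disc W'} (^≢0 12 {q (+ 3)} (λ ())) D′≢0)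
                                        (cong (ℤ._+ v3ℚ (disc W')) v3ℚ-3^12))
  12+v≰v : ∀ v → ¬ (+ 12 ℤ.+ v ℤ.≤ v)
  12+v≰v v 12+v≤v = ℤP.<-irrefl refl (ℤP.<-≤-trans v<12+v 12+v≤v)
    where
    v<12+v : v ℤ.< + 12 ℤ.+ v
    v<12+v = subst (ℤ._< + 12 ℤ.+ v) (ℤP.+-identityˡ v) (ℤP.+-monoˡ-< v (ℤ.+<+ (ℕ.s≤s ℕ.z≤n)))

-- Short Weierstrass models

short : ℚ → ℚ → Model
short X Y = mkModel 0ℚ 0ℚ 0ℚ X Y

short-integral : ∀ {X Y} → X ∈ℤ₍₃₎ → Y ∈ℤ₍₃₎ → Integral3 (short X Y)
short-integral X∈ Y∈ = 3∤↧ (integral-q (+ 0)) , 3∤↧ (integral-q (+ 0)) , 3∤↧ (integral-q (+ 0)) , 3∤↧ X∈ , 3∤↧ Y∈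

disc-short : ∀ X Y → disc (short X Y) ≡ q (ℤ.- + 16) * (q (+ 4) * X * X * X + q (+ 27) * Y * Y)
disc-short X Y = solve 2 (λ X Y → discPoly (con 0ℚ) (con 0ℚ) (con 0ℚ) X Y
  := con (q (ℤ.- + 16)) :* (con (q (+ 4)) :* X :* X :* X :+ con (q (+ 27)) :* Y :* Y)) refl X Y
  where open +-*-Solver

translate-short : ∀ r s t X Y → translate r s t (short X Y) ≡
  mkModel (q (+ 2) * s) (q (+ 3) * r - s * s) (q (+ 2) * t)
          (X + q (+ 3) * r * r - q (+ 2) * s * t) (Y + r * X + r * r * r - t * t)
translate-short r s t X Y = mkModel-cong (ℚP.+-identityˡ (q (+ 2) * s)) (e2 r s) (e3 r t) (e4 X r s t) (e6 X Y r t)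
  where
  open +-*-Solver
  e2 : ∀ r s → 0ℚ - s * 0ℚ + q (+ 3) * r - s * s ≡ q (+ 3) * r - s * s
  e2 = solve 2 (λ r s → con 0ℚ :- s :* con 0ℚ :+ con (q (+ 3)) :* r :- s :* s := con (q (+ 3)) :* r :- s :* s) refl
  e3 : ∀ r t → 0ℚ + r * 0ℚ + q (+ 2) * t ≡ q (+ 2) * t
  e3 = solve 2 (λ r t → con 0ℚ :+ r :* con 0ℚ :+ con (q (+ 2)) :* t := con (q (+ 2)) :* t) refl
  e4 : ∀ X r s t → X - s * 0ℚ + q (+ 2) * r * 0ℚ - (t + r * s) * 0ℚ + q (+ 3) * r * r - q (+ 2) * s * t
                     ≡ X + q (+ 3) * r * r - q (+ 2) * s * t
  e4 = solve 4 (λ X r s t →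
         X :- s :* con 0ℚ :+ con (q (+ 2)) :* r :* con 0ℚ :- (t :+ r :* s) :* con 0ℚ
           :+ con (q (+ 3)) :* r :* r :- con (q (+ 2)) :* s :* t
         := X :+ con (q (+ 3)) :* r :* r :- con (q (+ 2)) :* s :* t) refl
  e6 : ∀ X Y r t → Y + r * X + r * r * 0ℚ + r * r * r - t * 0ℚ - t * t - r * t * 0ℚ
                     ≡ Y + r * X + r * r * r - t * t
  e6 = solve 4 (λ X Y r t →
         Y :+ r :* X :+ r :* r :* con 0ℚ :+ r :* r :* r :- t :* con 0ℚ :- t :* t :- r :* t :* con 0ℚ
         := Y :+ r :* X :+ r :* r :* r :- t :* t) refl

3∣u⇒div₃-coefficients : ∀ {X Y W'} (iso : Iso (short X Y) W') → Integral3 W' → Div₃ 1 (proj₁ iso) →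
          Div₃ 3 X × Div₃ 3 Y × (Div₃ 4 X → Div₃ 6 Y)
3∣u⇒div₃-coefficients {X} {Y} {W'} (u , r , s , t , _ , e1 , e2 , e3 , e4 , e6) (i1 , i2 , i3 , i4 , i6) u∈
  = X∈ , Y∈ , X∈₄⇒Y∈₆
  where
  W′≡ : scale u W' ≡ mkModel (q (+ 2) * s) (q (+ 3) * r - s * s) (q (+ 2) * t)
                             (X + q (+ 3) * r * r - q (+ 2) * s * t) (Y + r * X + r * r * r - t * t)
  W′≡ = trans (mkModel-cong e1 e2 e3 e4 e6) (translate-short r s t X Y)
  u²∈ : Div₃ 2 (u * u)
  u²∈ = div₃-* u∈ u∈
  u⁴∈ : Div₃ 4 (u * u * u * u)
  u⁴∈ = div₃-* (div₃-* u²∈ u∈) u∈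
  2s∈ : Div₃ 1 (q (+ 2) * s)
  2s∈ = subst (Div₃ 1) (cong a1 W′≡) (div₃-* u∈ (integral⇒div₃ (integral i1)))
  3r-s²∈ : Div₃ 2 (q (+ 3) * r - s * s)
  3r-s²∈ = subst (Div₃ 2) (cong a2 W′≡) (div₃-* u²∈ (integral⇒div₃ (integral i2)))
  2t∈ : Div₃ 3 (q (+ 2) * t)
  2t∈ = subst (Div₃ 3) (cong a3 W′≡) (div₃-* (div₃-* u²∈ u∈) (integral⇒div₃ (integral i3)))
  a4∈ : Div₃ 4 (X + q (+ 3) * r * r - q (+ 2) * s * t)
  a4∈ = subst (Div₃ 4) (cong a4 W′≡) (div₃-* u⁴∈ (integral⇒div₃ (integral i4)))
  a6∈ : Div₃ 6 (Y + r * X + r * r * r - t * t)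
  a6∈ = subst (Div₃ 6) (cong a6 W′≡) (div₃-* (div₃-* (div₃-* u⁴∈ u∈) u∈) (integral⇒div₃ (integral i6)))
  s∈ : Div₃ 1 s
  s∈ = div₃-cancel-unit (+ 2) (from-no (3 ∣? 2)) 2s∈
  r∈ : Div₃ 1 r
  r∈ = div₃-cancel-3^ {1} {1} (div₃-+-cancelʳ 3r-s²∈ (div₃-neg (div₃-* s∈ s∈)))
  t∈ : Div₃ 3 t
  t∈ = div₃-cancel-unit (+ 2) (from-no (3 ∣? 2)) 2t∈
  2st∈ : Div₃ 4 (q (+ 2) * s * t)
  2st∈ = div₃-* (div₃-* (integral⇒div₃ (integral-q (+ 2))) s∈) t∈
  X+3r²∈ : Div₃ 4 (X + q (+ 3) * r * r)
  X+3r²∈ = div₃-+-cancelʳ a4∈ (div₃-neg 2st∈)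
  X∈ : Div₃ 3 X
  X∈ = div₃-+-cancelʳ (div₃-≤ (ℕP.n≤1+n 3) X+3r²∈) (div₃-* (div₃-* (div₃-3^ℚ 1) r∈) r∈)
  Y∈ : Div₃ 3 Y
  Y∈ = div₃-+-cancelʳ (div₃-+-cancelʳ (div₃-+-cancelʳ (div₃-≤ 3≤6 a6∈) (div₃-neg (div₃-≤ 3≤6 (div₃-* t∈ t∈))))
                                     (div₃-* (div₃-* r∈ r∈) r∈))
                     (div₃-≤ (ℕP.n≤1+n 3) (div₃-* r∈ X∈))
    where
    3≤6 : 3 ℕ.≤ 6
    3≤6 = ℕP.m≤m+n 3 3
  X∈₄⇒Y∈₆ : Div₃ 4 X → Div₃ 6 Y
  X∈₄⇒Y∈₆ X∈₄ = div₃-+-cancelʳ (div₃-+-cancelʳ (div₃-+-cancelʳ a6∈ (div₃-neg (div₃-* t∈ t∈)))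
                                              (div₃-* (div₃-* r∈₂ r∈₂) r∈₂))
                              (div₃-* r∈₂ X∈₄)
    where
    3r²∈ : Div₃ 4 (q (+ 3) * (r * r))
    3r²∈ = subst (Div₃ 4) (ℚP.*-assoc (q (+ 3)) r r) (div₃-+-cancelˡ X+3r²∈ X∈₄)
    r∈₂ : Div₃ 2 r
    r∈₂ = div₃-sq r∈ (div₃-cancel-3^ {1} {3} 3r²∈)

short-disc-div₃⇒div₃-4 : ∀ {X Y} → Div₃ 3 X → Div₃ 4 Y → Div₃ 12 (disc (short X Y)) → Div₃ 4 X
short-disc-div₃⇒div₃-4 {X} {Y} X∈ Y∈ D∈ = div₃-cube X∈ (div₃-≤ (ℕP.n≤1+n 10) X³∈)
  where
  N∈ : Div₃ 12 (q (+ 4) * X * X * X + q (+ 27) * Y * Y)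
  N∈ = div₃-cancel-unit (ℤ.- + 16) (from-no (3 ∣? 16)) (subst (Div₃ 12) (disc-short X Y) D∈)
  4X³∈ : Div₃ 11 (q (+ 4) * (X * X * X))
  4X³∈ = subst (Div₃ 11) (trans (ℚP.*-assoc (q (+ 4) * X) X X)
                          (trans (ℚP.*-assoc (q (+ 4)) X (X * X)) (cong (q (+ 4) *_) (sym (ℚP.*-assoc X X X)))))
           (div₃-+-cancelʳ (div₃-≤ (ℕP.n≤1+n 11) N∈) (div₃-* (div₃-* (div₃-3^ℚ 3) Y∈) Y∈))
  X³∈ : Div₃ 11 (X * X * X)
  X³∈ = div₃-cancel-unit (+ 4) (from-no (3 ∣? 4)) 4X³∈

Exactly₃ : ℕ → ℚ → Set
Exactly₃ k x = Div₃ k x × ¬ Div₃ (suc k) x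

Reducible₃ : ℚ → ℚ → Set
Reducible₃ X Y = (Div₃ 4 X × Div₃ 6 Y) ⊎ (Exactly₃ 3 X × Exactly₃ 3 Y × Div₃ 12 (disc (short X Y)))

reducible₃? : ∀ {X Y} → X ∈ℤ₍₃₎ → Y ∈ℤ₍₃₎ → Dec (Reducible₃ X Y)
reducible₃? {X} {Y} X∈ Y∈ =
  (div₃? X∈ 4 ×-dec div₃? Y∈ 6)
  ⊎-dec (exactly? X∈ ×-dec exactly? Y∈ ×-dec div₃? (integral-disc {short X Y} (short-integral X∈ Y∈)) 12)
  where
  exactly? : ∀ {x} → x ∈ℤ₍₃₎ → Dec (Exactly₃ 3 x)
  exactly? x∈ = div₃? x∈ 3 ×-dec ¬? (div₃? x∈ 4)

3∣u⇒reducible₃ : ∀ {X Y W'} (iso : Iso (short X Y) W') → Integral3 W' → Div₃ 1 (proj₁ iso) → Reducible₃ X Y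
3∣u⇒reducible₃ {X} {Y} {W'} iso W'∈ u∈ = classify (div₃? (div₃⇒integral X∈) 4) (div₃? (div₃⇒integral Y∈) 4)
  where
  analysis : Div₃ 3 X × Div₃ 3 Y × (Div₃ 4 X → Div₃ 6 Y)
  analysis = 3∣u⇒div₃-coefficients {X} {Y} {W'} iso W'∈ u∈
  X∈ : Div₃ 3 X
  X∈ = proj₁ analysis
  Y∈ : Div₃ 3 Y
  Y∈ = proj₁ (proj₂ analysis)
  D∈ : Div₃ 12 (disc (short X Y))
  D∈ = 3∣u⇒disc-div₃-12 {short X Y} {W'} iso W'∈ u∈
  classify : Dec (Div₃ 4 X) → Dec (Div₃ 4 Y) → Reducible₃ X Y
  classify (yes X∈₄) _         = inj₁ (X∈₄ , proj₂ (proj₂ analysis) X∈₄)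
  classify (no X∉₄)  (yes Y∈₄) = contradiction (short-disc-div₃⇒div₃-4 X∈ Y∈₄ D∈) X∉₄
  classify (no X∉₄)  (no Y∉₄)  = inj₂ ((X∈ , X∉₄) , (Y∈ , Y∉₄) , D∈)

minimal-if-irreducible : ∀ {X Y} → X ∈ℤ₍₃₎ → Y ∈ℤ₍₃₎ → disc (short X Y) ≢ 0ℚ → ¬ Reducible₃ X Y → Minimal3 (short X Y)
minimal-if-irreducible {X} {Y} X∈ Y∈ D≢0 irreducible = short∈ , bound
  where
  short∈ : Integral3 (short X Y)
  short∈ = short-integral X∈ Y∈
  bound : ∀ W' → Iso (short X Y) W' → Integral3 W' → v3ℚ (disc (short X Y)) ℤ.≤ v3ℚ (disc W')
  bound W' iso W'∈ = [ (λ u∈ → contradiction (3∣u⇒reducible₃ {X} {Y} {W'} iso W'∈ u∈) irreducible)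
                     , v3ℚ-disc-≤ {short X Y} {W'} iso D≢0 ]′ (div₃₁⊎3∤↥ (proj₁ iso))

¬minimal-if-div₃-4-6 : ∀ {X Y} → disc (short X Y) ≢ 0ℚ → Div₃ 4 X → Div₃ 6 Y → ¬ Minimal3 (short X Y)
¬minimal-if-div₃-4-6 D≢0 (div₃ x′ x′∈ refl) (div₃ y′ y′∈ refl) =
  ¬minimal-by-3 {W} {W'} (iso-from-scale {W} {W'} (q (+ 3)) 0ℚ 0ℚ 0ℚ (λ ()) W′≡) refl D≢0 (short-integral x′∈ y′∈)
  where
  W W' : Model
  W = short (3^ℚ 4 * x′) (3^ℚ 6 * y′)
  W' = short x′ y′
  c4 : ∀ x′ → q (+ 3) * q (+ 3) * q (+ 3) * q (+ 3) * x′ ≡ 3^ℚ 4 * x′ + q (+ 3) * 0ℚ * 0ℚ - q (+ 2) * 0ℚ * 0ℚ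
  c4 = solve 1 (λ x′ →
         con (q (+ 3)) :* con (q (+ 3)) :* con (q (+ 3)) :* con (q (+ 3)) :* x′
         := con (3^ℚ 4) :* x′ :+ con (q (+ 3)) :* con 0ℚ :* con 0ℚ :- con (q (+ 2)) :* con 0ℚ :* con 0ℚ) refl
    where open +-*-Solver
  c6 : ∀ x′ y′ → q (+ 3) * q (+ 3) * q (+ 3) * q (+ 3) * q (+ 3) * q (+ 3) * y′
                   ≡ 3^ℚ 6 * y′ + 0ℚ * (3^ℚ 4 * x′) + 0ℚ * 0ℚ * 0ℚ - 0ℚ * 0ℚ
  c6 = solve 2 (λ x′ y′ →
         con (q (+ 3)) :* con (q (+ 3)) :* con (q (+ 3)) :* con (q (+ 3)) :* con (q (+ 3)) :* con (q (+ 3)) :* y′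
         := con (3^ℚ 6) :* y′ :+ con 0ℚ :* (con (3^ℚ 4) :* x′) :+ con 0ℚ :* con 0ℚ :* con 0ℚ :- con 0ℚ :* con 0ℚ) refl
    where open +-*-Solver
  W′≡ : scale (q (+ 3)) W' ≡ translate 0ℚ 0ℚ 0ℚ W
  W′≡ = trans (mkModel-cong refl refl refl (c4 x′) (c6 x′ y′))
              (sym (translate-short 0ℚ 0ℚ 0ℚ (3^ℚ 4 * x′) (3^ℚ 6 * y′)))

≡-modulo : ∀ {L R} a b c d e f → L ≡ R + a * (b - c) + d * (e - f) → b ≡ c → e ≡ f → L ≡ R
≡-modulo {L} {R} a b c d e f L≡ refl refl = trans L≡ (vanish R a c d e)
  where
  vanish : ∀ R a c d e → R + a * (c - c) + d * (e - e) ≡ R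
  vanish = solve 5 (λ R a c d e → R :+ a :* (c :- c) :+ d :* (e :- e) := R) refl
    where open +-*-Solver

-- Here X = 27B₄ and Y = 27B₆ with 3 ∤ B₄, and 3¹² ∣ Δ gives 4B₄³ + B₆² = 27M.  With w = (2B₄)⁻¹ the
-- translation r = -3B₆w makes W' 3-integral; its coefficient identities hold modulo these two relations.
¬minimal-if-div₃-3-3 : ∀ {X Y} → disc (short X Y) ≢ 0ℚ → Div₃ 3 X → ¬ Div₃ 4 X → Div₃ 3 Y →
                        Div₃ 12 (disc (short X Y)) → ¬ Minimal3 (short X Y)
¬minimal-if-div₃-3-3 D≢0 X∈@(div₃ B4 B4∈ refl) X∉₄ (div₃ B6 B6∈ refl) D∈ =
  ¬minimal-by-3 {W} {W'} (iso-from-scale {W} {W'} (q (+ 3)) r 0ℚ 0ℚ (λ ()) W′≡) refl D≢0 W'∈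
  where
  open +-*-Solver using (solve; _:=_; _:+_; _:*_; _:-_; :-_; con)
  N : ℚ
  N = q (+ 4) * B4 * B4 * B4 + B6 * B6
  N∈ : Div₃ 3 N
  N∈ = div₃-cancel-unit (ℤ.- + 16) (from-no (3 ∣? 16)) (div₃-cancel-3^ {9} {3} (subst (Div₃ 12) D≡ D∈))
    where
    extract : ∀ B4 B6 → q (ℤ.- + 16) * (q (+ 4) * (3^ℚ 3 * B4) * (3^ℚ 3 * B4) * (3^ℚ 3 * B4)
                                          + q (+ 27) * (3^ℚ 3 * B6) * (3^ℚ 3 * B6))
                          ≡ 3^ℚ 9 * (q (ℤ.- + 16) * (q (+ 4) * B4 * B4 * B4 + B6 * B6))
    extract = solve 2 (λ B4 B6 →
      con (q (ℤ.- + 16)) :* (con (q (+ 4)) :* (con (3^ℚ 3) :* B4) :* (con (3^ℚ 3) :* B4) :* (con (3^ℚ 3) :* B4)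
                             :+ con (q (+ 27)) :* (con (3^ℚ 3) :* B6) :* (con (3^ℚ 3) :* B6))
      := con (3^ℚ 9) :* (con (q (ℤ.- + 16)) :* (con (q (+ 4)) :* B4 :* B4 :* B4 :+ B6 :* B6))) refl
    D≡ : disc (short (3^ℚ 3 * B4) (3^ℚ 3 * B6)) ≡ 3^ℚ 9 * (q (ℤ.- + 16) * N)
    D≡ = trans (disc-short (3^ℚ 3 * B4) (3^ℚ 3 * B6)) (extract B4 B6)
  M : ℚ
  M = Div₃.cofactor N∈
  2B4∉ : ¬ Div₃ 1 (q (+ 2) * B4)
  2B4∉ 2B4∈ = X∉₄ (div₃-lift X∈ (div₃-cancel-unit (+ 2) (from-no (3 ∣? 2)) 2B4∈))
  inverse : ∃ λ w → w ∈ℤ₍₃₎ × q (+ 2) * B4 * w ≡ 1ℚ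
  inverse = integral-inverse (integral-* (integral-q (+ 2)) B4∈) 2B4∉
  w : ℚ
  w = proj₁ inverse
  r : ℚ
  r = q (ℤ.- + 3) * B6 * w
  W W' : Model
  W = short (3^ℚ 3 * B4) (3^ℚ 3 * B6)
  W' = mkModel 0ℚ (- (B6 * w)) 0ℚ (q (+ 9) * M * w * w) (- (B6 * M * w * w * w))
  W'∈ : Integral3 W'
  W'∈ = 3∤↧ (integral-q (+ 0)) , 3∤↧ (integral-neg (B6∈ ⊗ w∈)) , 3∤↧ (integral-q (+ 0)) ,
        3∤↧ (integral-q (+ 9) ⊗ M∈ ⊗ w∈ ⊗ w∈) , 3∤↧ (integral-neg (B6∈ ⊗ M∈ ⊗ w∈ ⊗ w∈ ⊗ w∈))
    where
    _⊗_ : ∀ {x y} → x ∈ℤ₍₃₎ → y ∈ℤ₍₃₎ → x * y ∈ℤ₍₃₎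
    _⊗_ = integral-*
    infixl 7 _⊗_
    M∈ : M ∈ℤ₍₃₎
    M∈ = Div₃.cofactor∈ℤ₍₃₎ N∈
    w∈ : w ∈ℤ₍₃₎
    w∈ = proj₁ (proj₂ inverse)
  c2 : ∀ B6 w → q (+ 3) * q (+ 3) * - (B6 * w) ≡ q (+ 3) * (q (ℤ.- + 3) * B6 * w) - 0ℚ * 0ℚ
  c2 = solve 2 (λ B6 w → con (q (+ 3)) :* con (q (+ 3)) :* :- (B6 :* w)
                        := con (q (+ 3)) :* (con (q (ℤ.- + 3)) :* B6 :* w) :- con 0ℚ :* con 0ℚ) refl
  c4 : q (+ 3) * q (+ 3) * q (+ 3) * q (+ 3) * (q (+ 9) * M * w * w)
         ≡ 3^ℚ 3 * B4 + q (+ 3) * r * r - q (+ 2) * 0ℚ * 0ℚ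
  c4 = ≡-modulo (q (ℤ.- + 27) * w * w) N (3^ℚ 3 * M)
         (q (+ 27) * B4 * (q (+ 2) * B4 * w + 1ℚ)) (q (+ 2) * B4 * w) 1ℚ
         (identity B4 B6 M w) (Div₃.factorises N∈) (proj₂ (proj₂ inverse))
    where
    identity : ∀ B4 B6 M w →
      q (+ 3) * q (+ 3) * q (+ 3) * q (+ 3) * (q (+ 9) * M * w * w)
        ≡ 3^ℚ 3 * B4 + q (+ 3) * (q (ℤ.- + 3) * B6 * w) * (q (ℤ.- + 3) * B6 * w) - q (+ 2) * 0ℚ * 0ℚ
          + q (ℤ.- + 27) * w * w * ((q (+ 4) * B4 * B4 * B4 + B6 * B6) - 3^ℚ 3 * M)
          + q (+ 27) * B4 * (q (+ 2) * B4 * w + 1ℚ) * (q (+ 2) * B4 * w - 1ℚ)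
    identity = solve 4 (λ B4 B6 M w →
      con (q (+ 3)) :* con (q (+ 3)) :* con (q (+ 3)) :* con (q (+ 3)) :* (con (q (+ 9)) :* M :* w :* w)
      := con (3^ℚ 3) :* B4 :+ con (q (+ 3)) :* (con (q (ℤ.- + 3)) :* B6 :* w) :* (con (q (ℤ.- + 3)) :* B6 :* w)
           :- con (q (+ 2)) :* con 0ℚ :* con 0ℚ
         :+ con (q (ℤ.- + 27)) :* w :* w :* ((con (q (+ 4)) :* B4 :* B4 :* B4 :+ B6 :* B6) :- con (3^ℚ 3) :* M)
         :+ con (q (+ 27)) :* B4 :* (con (q (+ 2)) :* B4 :* w :+ con 1ℚ) :* (con (q (+ 2)) :* B4 :* w :- con 1ℚ)) refl
  c6 : q (+ 3) * q (+ 3) * q (+ 3) * q (+ 3) * q (+ 3) * q (+ 3) * - (B6 * M * w * w * w)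
         ≡ 3^ℚ 3 * B6 + r * (3^ℚ 3 * B4) + r * r * r - 0ℚ * 0ℚ
  c6 = ≡-modulo (q (+ 27) * B6 * w * w * w) N (3^ℚ 3 * M)
         (q (ℤ.- + 27) * B6 * (q (+ 2) * B4 * w - 1ℚ) * (B4 * w + 1ℚ)) (q (+ 2) * B4 * w) 1ℚ
         (identity B4 B6 M w) (Div₃.factorises N∈) (proj₂ (proj₂ inverse))
    where
    identity : ∀ B4 B6 M w →
      q (+ 3) * q (+ 3) * q (+ 3) * q (+ 3) * q (+ 3) * q (+ 3) * - (B6 * M * w * w * w)
        ≡ 3^ℚ 3 * B6 + q (ℤ.- + 3) * B6 * w * (3^ℚ 3 * B4)
          + q (ℤ.- + 3) * B6 * w * (q (ℤ.- + 3) * B6 * w) * (q (ℤ.- + 3) * B6 * w) - 0ℚ * 0ℚ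
          + q (+ 27) * B6 * w * w * w * ((q (+ 4) * B4 * B4 * B4 + B6 * B6) - 3^ℚ 3 * M)
          + q (ℤ.- + 27) * B6 * (q (+ 2) * B4 * w - 1ℚ) * (B4 * w + 1ℚ) * (q (+ 2) * B4 * w - 1ℚ)
    identity = solve 4 (λ B4 B6 M w →
      con (q (+ 3)) :* con (q (+ 3)) :* con (q (+ 3)) :* con (q (+ 3)) :* con (q (+ 3)) :* con (q (+ 3))
        :* :- (B6 :* M :* w :* w :* w)
      := con (3^ℚ 3) :* B6 :+ con (q (ℤ.- + 3)) :* B6 :* w :* (con (3^ℚ 3) :* B4)
           :+ con (q (ℤ.- + 3)) :* B6 :* w :* (con (q (ℤ.- + 3)) :* B6 :* w) :* (con (q (ℤ.- + 3)) :* B6 :* w)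
           :- con 0ℚ :* con 0ℚ
         :+ con (q (+ 27)) :* B6 :* w :* w :* w :* ((con (q (+ 4)) :* B4 :* B4 :* B4 :+ B6 :* B6) :- con (3^ℚ 3) :* M)
         :+ con (q (ℤ.- + 27)) :* B6 :* (con (q (+ 2)) :* B4 :* w :- con 1ℚ) :* (B4 :* w :+ con 1ℚ)
            :* (con (q (+ 2)) :* B4 :* w :- con 1ℚ)) refl
  W′≡ : scale (q (+ 3)) W' ≡ translate r 0ℚ 0ℚ W
  W′≡ = trans (mkModel-cong refl (c2 B6 w) refl c4 c6) (sym (translate-short r 0ℚ 0ℚ (3^ℚ 3 * B4) (3^ℚ 3 * B6)))

¬minimal⇔reducible₃ : ∀ {X Y} → X ∈ℤ₍₃₎ → Y ∈ℤ₍₃₎ → disc (short X Y) ≢ 0ℚ → (¬ Minimal3 (short X Y)) ⇔ Reducible₃ X Y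
¬minimal⇔reducible₃ {X} {Y} X∈ Y∈ D≢0 = mk⇔ to from
  where
  decide : Dec (Reducible₃ X Y) → ¬ Minimal3 (short X Y) → Reducible₃ X Y
  decide (yes reducible)  _        = reducible
  decide (no irreducible) ¬minimal = contradiction (minimal-if-irreducible X∈ Y∈ D≢0 irreducible) ¬minimal
  to : ¬ Minimal3 (short X Y) → Reducible₃ X Y
  to = decide (reducible₃? X∈ Y∈)
  from : Reducible₃ X Y → ¬ Minimal3 (short X Y)
  from (inj₁ (X∈₄ , Y∈₆))                     = ¬minimal-if-div₃-4-6 D≢0 X∈₄ Y∈₆
  from (inj₂ ((X∈₃ , X∉₄) , (Y∈₃ , _) , D∈)) = ¬minimal-if-div₃-3-3 D≢0 X∈₃ X∉₄ Y∈₃ D∈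

q-Δshort : ∀ A4 A6 → q (Δshort A4 A6) ≡ q (ℤ.- + 16) * (q (+ 4) * q A4 * q A4 * q A4 + q (+ 27) * q A6 * q A6)
q-Δshort A4 A6 = begin
  q (c ℤ.* (cube ℤ.+ square))         ≡⟨ q-* c (cube ℤ.+ square) ⟩
  q c * q (cube ℤ.+ square)           ≡⟨ cong (q c *_) (q-+ cube square) ⟩
  q c * (q cube + q square)           ≡⟨ cong₂ (λ a b → q c * (a + b)) q-cube q-square ⟩
  q c * (q (+ 4) * q A4 * q A4 * q A4 + q (+ 27) * q A6 * q A6) ∎
  where
  open ≡-Reasoning
  c cube square : ℤ
  c = ℤ.- + 16
  cube = + 4 ℤ.* A4 ℤ.* A4 ℤ.* A4
  square = + 27 ℤ.* A6 ℤ.* A6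
  q-cube : q cube ≡ q (+ 4) * q A4 * q A4 * q A4
  q-cube = trans (q-* (+ 4 ℤ.* A4 ℤ.* A4) A4) (cong (_* q A4)
             (trans (q-* (+ 4 ℤ.* A4) A4) (cong (_* q A4) (q-* (+ 4) A4))))
  q-square : q square ≡ q (+ 27) * q A6 * q A6
  q-square = trans (q-* (+ 27 ℤ.* A6) A6) (cong (_* q A6) (q-* (+ 27) A6))

disc-shortModel : ∀ A4 A6 → disc (shortModel A4 A6) ≡ q (Δshort A4 A6)
disc-shortModel A4 A6 = trans (disc-short (q A4) (q A6)) (sym (q-Δshort A4 A6))

fin≤v3ℤ⇔div₃ : ∀ k n → fin k ≤∞ v3ℤ n ⇔ Div₃ k (q n)
fin≤v3ℤ⇔div₃ k n = ⇔.trans (fin≤v3ℤ⇔3^∣ k n) (⇔.sym (div₃-q⇔3^∣ n))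

v3ℤ≡fin⇔exactly₃ : ∀ k n → v3ℤ n ≡ fin k ⇔ Exactly₃ k (q n)
v3ℤ≡fin⇔exactly₃ k n = ⇔.trans ≡fin⇔ (fin≤v3ℤ⇔div₃ k n ×-⇔ ¬-cong-⇔ (fin≤v3ℤ⇔div₃ (suc k) n))

lemma2p2 : (A4 A6 : ℤ) → ¬ (Δshort A4 A6 ≡ + 0) →
    ((¬ Minimal3 (shortModel A4 A6))
      ⇔ ((fin 4 ≤∞ v3ℤ A4 × fin 6 ≤∞ v3ℤ A6)
         ⊎ (v3ℤ A4 ≡ fin 3 × v3ℤ A6 ≡ fin 3 × fin 12 ≤∞ v3ℤ (Δshort A4 A6))))
lemma2p2 A4 A6 Δ≢0 = ⇔.trans (¬minimal⇔reducible₃ (integral-q A4) (integral-q A6) D≢0) (⇔.sym valuation-form)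
  where
  D≡Δ : disc (shortModel A4 A6) ≡ q (Δshort A4 A6)
  D≡Δ = disc-shortModel A4 A6
  D≢0 : disc (shortModel A4 A6) ≢ 0ℚ
  D≢0 = subst (_≢ 0ℚ) (sym D≡Δ) (q≢0 Δ≢0)
  valuation-form : ((fin 4 ≤∞ v3ℤ A4 × fin 6 ≤∞ v3ℤ A6)
                     ⊎ (v3ℤ A4 ≡ fin 3 × v3ℤ A6 ≡ fin 3 × fin 12 ≤∞ v3ℤ (Δshort A4 A6)))
                   ⇔ Reducible₃ (q A4) (q A6)
  valuation-form = (fin≤v3ℤ⇔div₃ 4 A4 ×-⇔ fin≤v3ℤ⇔div₃ 6 A6)
    ⊎-⇔ (v3ℤ≡fin⇔exactly₃ 3 A4 ×-⇔ v3ℤ≡fin⇔exactly₃ 3 A6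
          ×-⇔ subst (λ D → fin 12 ≤∞ v3ℤ (Δshort A4 A6) ⇔ Div₃ 12 D) (sym D≡Δ) (fin≤v3ℤ⇔div₃ 12 (Δshort A4 A6)))
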